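{- For all integers $n\geq 1$ and $p\geq 0$, \begin{align*} \sum_{j=1}^n \binom{p+j}{j}\binom{2(n-j)}{n-j}\frac{4^j}{j}O_{n-j} &= -\binom{2n}{n}H_pO_n + 2^{2n-1}S_n - \sum_{j=0}^{n-1}4^{n-j-1}C_jS_{n-j-1}\\ &\quad+\frac12\sum_{k=1}^p\frac1k\left(4^n\binom{n+k}{n}\big(H_{n+k}-H_k\big) - \frac12\sum_{j=1}^n\binom{j+k-1}{j-1}4^j\big(H_{k+j-1}-H_k\big)C_{n-j}\right). \end{align*} In particular, for all $n\ge 1$, \[ \sum_{j=1}^n\binom{2(n-j)}{n-j}\frac{4^j}{j}O_{n-j} = 2^{2n-1}S_n - \sum_{j=1}^n 4^{j-1}C_{n-j}S_{j-1}. \]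
   Context: $H_n=\sum_{j=1}^n \frac1j$ (with $H_0=0$), $O_n=\sum_{j=1}^n\frac{1}{2j-1}$ (with $O_0=0$), $C_n=\frac{1}{n+1}\binom{2n}{n}$ is the $n$th Catalan number, and for $n\ge1$, $S_n=\sum_{m=1}^n\frac{H_{n-m}}{m}$, with $S_0=0$. -}

module Defs where

open import Data.Nat as ℕ using (ℕ; zero; suc; _∸_)
open import Data.Nat.Combinatorics using (_C_)
open import Data.Integer as ℤ using (+_)
open import Data.Rational using (ℚ; _/_; _+_; _*_; -_; 0ℚ)

⟦_⟧ : ℕ → ℚ
⟦ n ⟧ = (+ n) / 1

-- 1 / k for k ≥ 1, written via suc so no NonZero hypothesis is needed
inv-suc : ℕ → ℚ
inv-suc k = (+ 1) / suc k

sum1 : ℕ → (ℕ → ℚ) → ℚ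
sum1 zero    f = 0ℚ
sum1 (suc n) f = sum1 n f + f (suc n)

sum0 : ℕ → (ℕ → ℚ) → ℚ
sum0 zero    f = 0ℚ
sum0 (suc n) f = sum0 n f + f n

-- 1/j for j ≥ 1 (value at 0 is irrelevant: only used for j ≥ 1)
recip : ℕ → ℚ
recip zero    = 0ℚ
recip (suc k) = inv-suc k

H : ℕ → ℚ
H n = sum1 n recip

O : ℕ → ℚ
O n = sum1 n (λ j → recip (2 ℕ.* j ∸ 1))

Cat : ℕ → ℚ
Cat n = (+ ((2 ℕ.* n) C n)) / suc n

S : ℕ → ℚ
S n = sum1 n (λ m → H (n ∸ m) * recip m)

binom : ℕ → ℕ → ℚ
binom n k = ⟦ n C k ⟧

pow4 : ℕ → ℚ
pow4 n = ⟦ 4 ℕ.^ n ⟧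

-- Read everything as coefficients of power series in x over ℚ. With ℓ = -log(1-4x) = Σ 4^j x^j / j
-- and β = (1-4x)^(-1/2) = Σ binom(2n,n) x^n, the series ω = Σ binom(2n,n) O_n x^n equals ½ β ℓ,
-- and β W = 1 for W = (1-4x)^(1/2) = 1 - 2 x C(x). Both are proved by showing that the two sides
-- satisfy the same first-order equation θ s = a x θ s + b x s + x f (θ = x d/dx) with the same
-- constant term; β² = 1/(1-4x) is proved the same way. Hence A ω = ½ W ℓ A / (1-4x) for every
-- series A. For A = ℓ, ℓ² / (1-4x) = Σ 4^n S_n x^n, which is the case p = 0. For the induction
-- on p, Pascal's rule splits binom(p+1+j, j) so that the sum grows by ([x^n] (1-4x)^(-p-1) ω - ω_n) / (p+1),
-- and ℓ (1-4x)^(-k-1) = Σ 4^n binom(n+k,n) (H_(n+k) - H_k) x^n turns this into the (p+1)-th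
-- correction term.

module Submission where

open import Defs
open import Data.Nat as ℕ using (ℕ; zero; suc; _∸_; _≤_; _<_; _≥_; z≤n; s≤s)
import Data.Nat.Properties as ℕP
open import Data.Nat.Combinatorics
  using (_C_; nCn≡1; nCk≡nC[n∸k]; nC1≡n; k>n⇒nCk≡0; nCk+nC[k+1]≡[n+1]C[k+1])
open import Data.Nat.Tactic.RingSolver using (solve-∀)
open import Data.Integer as ℤ using ()
import Data.Integer.Properties as ℤP
import Data.Nat.Coprimality as Coprimality
open import Data.Rational using (ℚ; mkℚ; _+_; _*_; -_; _-_; ½; 0ℚ; 1ℚ; _/_)
import Data.Rational.Properties as ℚP
open import Data.Rational.Solver using (module +-*-Solver)
open +-*-Solver using (solve; _:=_; _:+_; _:*_; _:-_; :-_; con)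
open import Data.Maybe using (Maybe; just; nothing)
open import Data.Product using (_×_; _,_)
open import Relation.Nullary using (yes; no)
open import Relation.Binary.PropositionalEquality
open import Relation.Binary.Structures using (IsEquivalence)
open import Algebra.Bundles using (CommutativeRing)
open import Algebra.Structures using (IsAbelianGroup)
import Algebra.Solver.Ring.AlmostCommutativeRing as ACR
import Relation.Binary.Reasoning.Setoid as SetoidReasoning

[n+1]C[k+1]≡nCk+nC[k+1] : ∀ n k → suc n C suc k ≡ n C k ℕ.+ n C suc k
[n+1]C[k+1]≡nCk+nC[k+1] n k = sym (nCk+nC[k+1]≡[n+1]C[k+1] n k)

nC0≡1 : ∀ n → n C 0 ≡ 1
nC0≡1 n = trans (nCk≡nC[n∸k] {0} {n} z≤n) (nCn≡1 n)

2[1+m]≡2+2m : ∀ m → 2 ℕ.* suc m ≡ suc (suc (2 ℕ.* m))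
2[1+m]≡2+2m = solve-∀

[k+1]*[n+1]C[k+1]≡[n+1]*nCk : ∀ n k → suc k ℕ.* (suc n C suc k) ≡ suc n ℕ.* (n C k)
[k+1]*[n+1]C[k+1]≡[n+1]*nCk n zero = begin
  1 ℕ.* (suc n C 1)  ≡⟨ ℕP.*-identityˡ _ ⟩
  suc n C 1          ≡⟨ nC1≡n (suc n) ⟩
  suc n              ≡⟨ ℕP.*-identityʳ (suc n) ⟨
  suc n ℕ.* 1        ≡⟨ cong (suc n ℕ.*_) (nC0≡1 n) ⟨
  suc n ℕ.* (n C 0)  ∎
  where open ≡-Reasoning
[k+1]*[n+1]C[k+1]≡[n+1]*nCk zero (suc k)
  rewrite k>n⇒nCk≡0 {1} {suc (suc k)} (s≤s (s≤s z≤n)) | k>n⇒nCk≡0 {0} {suc k} (s≤s z≤n)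
  = ℕP.*-zeroʳ (suc (suc k))
[k+1]*[n+1]C[k+1]≡[n+1]*nCk (suc n) (suc k) = begin
  suc (suc k) ℕ.* (suc (suc n) C suc (suc k))
    ≡⟨ cong (suc (suc k) ℕ.*_) ([n+1]C[k+1]≡nCk+nC[k+1] (suc n) (suc k)) ⟩
  suc (suc k) ℕ.* (X ℕ.+ Y)
    ≡⟨ expand k X Y ⟩
  suc k ℕ.* X ℕ.+ suc (suc k) ℕ.* Y ℕ.+ X
    ≡⟨ cong₂ (λ u v → u ℕ.+ v ℕ.+ X) ([k+1]*[n+1]C[k+1]≡[n+1]*nCk n k) ([k+1]*[n+1]C[k+1]≡[n+1]*nCk n (suc k)) ⟩
  suc n ℕ.* (n C k) ℕ.+ suc n ℕ.* (n C suc k) ℕ.+ X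
    ≡⟨ cong (ℕ._+ X) (ℕP.*-distribˡ-+ (suc n) (n C k) (n C suc k)) ⟨
  suc n ℕ.* (n C k ℕ.+ n C suc k) ℕ.+ X
    ≡⟨ cong (λ z → suc n ℕ.* z ℕ.+ X) ([n+1]C[k+1]≡nCk+nC[k+1] n k) ⟨
  suc n ℕ.* X ℕ.+ X
    ≡⟨ ℕP.+-comm (suc n ℕ.* X) X ⟩
  suc (suc n) ℕ.* X
    ∎
  where
  open ≡-Reasoning
  X = suc n C suc k
  Y = suc n C suc (suc k)
  expand : ∀ k X Y → suc (suc k) ℕ.* (X ℕ.+ Y) ≡ suc k ℕ.* X ℕ.+ suc (suc k) ℕ.* Y ℕ.+ X
  expand = solve-∀

[1+q]*[q+1+i]Ci≡[1+i]*[q+1+i]C[1+i] : ∀ q i →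
  suc q ℕ.* ((q ℕ.+ suc i) C i) ≡ suc i ℕ.* ((q ℕ.+ suc i) C suc i)
[1+q]*[q+1+i]Ci≡[1+i]*[q+1+i]C[1+i] q i rewrite ℕP.+-suc q i = begin
  suc q ℕ.* (suc N C i)       ≡⟨ cong (suc q ℕ.*_) (nCk≡nC[n∸k] i≤1+N) ⟩
  suc q ℕ.* (suc N C (suc N ∸ i)) ≡⟨ cong (λ k → suc q ℕ.* (suc N C k)) 1+N∸i≡1+q ⟩
  suc q ℕ.* (suc N C suc q)   ≡⟨ [k+1]*[n+1]C[k+1]≡[n+1]*nCk N q ⟩
  suc N ℕ.* (N C q)           ≡⟨ cong (suc N ℕ.*_) (nCk≡nC[n∸k] (ℕP.m≤m+n q i)) ⟩
  suc N ℕ.* (N C (N ∸ q))     ≡⟨ cong (λ k → suc N ℕ.* (N C k)) (ℕP.m+n∸m≡n q i) ⟩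
  suc N ℕ.* (N C i)           ≡⟨ [k+1]*[n+1]C[k+1]≡[n+1]*nCk N i ⟨
  suc i ℕ.* (suc N C suc i)   ∎
  where
  open ≡-Reasoning
  N = q ℕ.+ i
  i≤1+N : i ≤ suc N
  i≤1+N = ℕP.m≤n⇒m≤1+n (ℕP.m≤n+m i q)
  1+N∸i≡1+q : suc N ∸ i ≡ suc q
  1+N∸i≡1+q = trans (ℕP.+-∸-assoc 1 (ℕP.m≤n+m i q)) (cong suc (ℕP.m+n∸n≡m q i))

[1+m]*[2+2m]C[1+m]≡2[1+2m]*[2m]Cm : ∀ m →
  suc m ℕ.* ((2 ℕ.* suc m) C suc m) ≡ 2 ℕ.* suc (2 ℕ.* m) ℕ.* ((2 ℕ.* m) C m)
[1+m]*[2+2m]C[1+m]≡2[1+2m]*[2m]Cm m = ℕP.*-cancelˡ-≡ _ _ (suc m) (begin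
  suc m ℕ.* (suc m ℕ.* ((2 ℕ.* suc m) C suc m))
    ≡⟨ cong (λ z → suc m ℕ.* (suc m ℕ.* (z C suc m))) (2[1+m]≡2+2m m) ⟩
  suc m ℕ.* (suc m ℕ.* (suc (suc N) C suc m))
    ≡⟨ cong (suc m ℕ.*_) ([k+1]*[n+1]C[k+1]≡[n+1]*nCk (suc N) m) ⟩
  suc m ℕ.* (suc (suc N) ℕ.* (suc N C m))
    ≡⟨ cong (λ z → suc m ℕ.* (suc (suc N) ℕ.* z)) [1+N]Cm≡[1+N]C[1+m] ⟩
  suc m ℕ.* (suc (suc N) ℕ.* (suc N C suc m))
    ≡⟨ swap (suc m) (suc (suc N)) (suc N C suc m) ⟩
  suc (suc N) ℕ.* (suc m ℕ.* (suc N C suc m))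
    ≡⟨ cong (suc (suc N) ℕ.*_) ([k+1]*[n+1]C[k+1]≡[n+1]*nCk N m) ⟩
  suc (suc N) ℕ.* (suc N ℕ.* (N C m))
    ≡⟨ regroup m (N C m) ⟩
  suc m ℕ.* (2 ℕ.* suc (2 ℕ.* m) ℕ.* (N C m))
    ∎)
  where
  open ≡-Reasoning
  N = 2 ℕ.* m
  [1+N]Cm≡[1+N]C[1+m] : suc N C m ≡ suc N C suc m
  [1+N]Cm≡[1+N]C[1+m] = sym (begin
    suc N C suc m  ≡⟨ nCk≡nC[n∸k] (s≤s (ℕP.m≤m+n m (m ℕ.+ 0))) ⟩
    suc N C (N ∸ m) ≡⟨ cong (suc N C_) (ℕP.m+n∸m≡n m (m ℕ.+ 0)) ⟩
    suc N C (m ℕ.+ 0) ≡⟨ cong (suc N C_) (ℕP.+-identityʳ m) ⟩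
    suc N C m       ∎)
  swap : ∀ a b c → a ℕ.* (b ℕ.* c) ≡ b ℕ.* (a ℕ.* c)
  swap = solve-∀
  regroup : ∀ m c → suc (suc (2 ℕ.* m)) ℕ.* (suc (2 ℕ.* m) ℕ.* c) ≡ suc m ℕ.* (2 ℕ.* suc (2 ℕ.* m) ℕ.* c)
  regroup = solve-∀

⟦⟧≡mkℚ : ∀ n → ⟦ n ⟧ ≡ mkℚ (ℤ.+ n) 0 (Coprimality.sym (Coprimality.1-coprimeTo n))
⟦⟧≡mkℚ n = ℚP.normalize-coprime (Coprimality.sym (Coprimality.1-coprimeTo n))

⟦⟧-homo-+ : ∀ m n → ⟦ m ℕ.+ n ⟧ ≡ ⟦ m ⟧ + ⟦ n ⟧
⟦⟧-homo-+ m n rewrite ⟦⟧≡mkℚ m | ⟦⟧≡mkℚ n =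
  sym (ℚP./-cong (cong₂ ℤ._+_ (ℤP.*-identityʳ (ℤ.+ m)) (ℤP.*-identityʳ (ℤ.+ n))) refl)

⟦⟧-homo-* : ∀ m n → ⟦ m ℕ.* n ⟧ ≡ ⟦ m ⟧ * ⟦ n ⟧
⟦⟧-homo-* m n rewrite ⟦⟧≡mkℚ m | ⟦⟧≡mkℚ n = sym (ℚP./-cong (sym (ℤP.pos-* m n)) refl)

⟦1+k⟧*inv-suc≡1 : ∀ k → ⟦ suc k ⟧ * inv-suc k ≡ 1ℚ
⟦1+k⟧*inv-suc≡1 k rewrite ⟦⟧≡mkℚ (suc k) | ℚP.normalize-coprime (Coprimality.1-coprimeTo (suc k)) =
  ℚP.*-inverseʳ (mkℚ (ℤ.+ suc k) 0 (Coprimality.sym (Coprimality.1-coprimeTo (suc k))))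

inv-suc-cancelˡ : ∀ k x → inv-suc k * (⟦ suc k ⟧ * x) ≡ x
inv-suc-cancelˡ k x = begin
  inv-suc k * (⟦ suc k ⟧ * x)  ≡⟨ ℚP.*-assoc (inv-suc k) ⟦ suc k ⟧ x ⟨
  inv-suc k * ⟦ suc k ⟧ * x    ≡⟨ cong (_* x) (trans (ℚP.*-comm (inv-suc k) ⟦ suc k ⟧) (⟦1+k⟧*inv-suc≡1 k)) ⟩
  1ℚ * x                       ≡⟨ ℚP.*-identityˡ x ⟩
  x                            ∎
  where open ≡-Reasoning

⟦1+k⟧*[x*inv-suc]≡x : ∀ k x → ⟦ suc k ⟧ * (x * inv-suc k) ≡ x
⟦1+k⟧*[x*inv-suc]≡x k x = begin
  ⟦ suc k ⟧ * (x * inv-suc k)   ≡⟨ solve 3 (λ a x r → a :* (x :* r) := x :* (a :* r)) refl ⟦ suc k ⟧ x (inv-suc k) ⟩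
  x * (⟦ suc k ⟧ * inv-suc k)   ≡⟨ cong (x *_) (⟦1+k⟧*inv-suc≡1 k) ⟩
  x * 1ℚ                        ≡⟨ ℚP.*-identityʳ x ⟩
  x                             ∎
  where open ≡-Reasoning

⟦1+k⟧*-cancelˡ : ∀ k {x y} → ⟦ suc k ⟧ * x ≡ ⟦ suc k ⟧ * y → x ≡ y
⟦1+k⟧*-cancelˡ k {x} {y} eq = begin
  x                            ≡⟨ inv-suc-cancelˡ k x ⟨
  inv-suc k * (⟦ suc k ⟧ * x)  ≡⟨ cong (inv-suc k *_) eq ⟩
  inv-suc k * (⟦ suc k ⟧ * y)  ≡⟨ inv-suc-cancelˡ k y ⟩
  y                            ∎
  where open ≡-Reasoning

*inv-suc-swap : ∀ q i {x y} → ⟦ suc q ⟧ * x ≡ ⟦ suc i ⟧ * y → x * inv-suc i ≡ inv-suc q * y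
*inv-suc-swap q i {x} {y} eq = begin
  x * inv-suc i                            ≡⟨ inv-suc-cancelˡ q _ ⟨
  inv-suc q * (⟦ suc q ⟧ * (x * inv-suc i)) ≡⟨ cong (inv-suc q *_) (ℚP.*-assoc ⟦ suc q ⟧ x (inv-suc i)) ⟨
  inv-suc q * (⟦ suc q ⟧ * x * inv-suc i)   ≡⟨ cong (λ z → inv-suc q * (z * inv-suc i)) eq ⟩
  inv-suc q * (⟦ suc i ⟧ * y * inv-suc i)   ≡⟨ cong (inv-suc q *_) (cancel ⟦ suc i ⟧ y (inv-suc i)) ⟩
  inv-suc q * (y * (⟦ suc i ⟧ * inv-suc i)) ≡⟨ cong (λ z → inv-suc q * (y * z)) (⟦1+k⟧*inv-suc≡1 i) ⟩
  inv-suc q * (y * 1ℚ)                      ≡⟨ cong (inv-suc q *_) (ℚP.*-identityʳ y) ⟩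
  inv-suc q * y                             ∎
  where
  open ≡-Reasoning
  cancel : ∀ a b c → a * b * c ≡ b * (a * c)
  cancel = solve 3 (λ a b c → a :* b :* c := b :* (a :* c)) refl

/suc≡*inv-suc : ∀ a m → (ℤ.+ a) / suc m ≡ ⟦ a ⟧ * inv-suc m
/suc≡*inv-suc a m rewrite ⟦⟧≡mkℚ a | ℚP.normalize-coprime (Coprimality.1-coprimeTo (suc m)) =
  sym (ℚP./-cong (ℤP.*-identityʳ (ℤ.+ a)) (ℕP.*-identityˡ (suc m)))

pow4-suc : ∀ m → pow4 (suc m) ≡ ⟦ 4 ⟧ * pow4 m
pow4-suc m = ⟦⟧-homo-* 4 (4 ℕ.^ m)

pow4-+ : ∀ m n → pow4 (m ℕ.+ n) ≡ pow4 m * pow4 n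
pow4-+ m n = trans (cong ⟦_⟧ (ℕP.^-distribˡ-+-* 4 m n)) (⟦⟧-homo-* (4 ℕ.^ m) (4 ℕ.^ n))

sum0-cong-< : ∀ n {f g : ℕ → ℚ} → (∀ j → j < n → f j ≡ g j) → sum0 n f ≡ sum0 n g
sum0-cong-< zero    f≡g = refl
sum0-cong-< (suc n) f≡g = cong₂ _+_ (sum0-cong-< n (λ j j<n → f≡g j (ℕP.m<n⇒m<1+n j<n))) (f≡g n ℕP.≤-refl)

sum0-cong : ∀ n {f g : ℕ → ℚ} → (∀ j → f j ≡ g j) → sum0 n f ≡ sum0 n g
sum0-cong n f≡g = sum0-cong-< n (λ j _ → f≡g j)

sum0-+ : ∀ n (f g : ℕ → ℚ) → sum0 n (λ j → f j + g j) ≡ sum0 n f + sum0 n g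
sum0-+ zero    f g = refl
sum0-+ (suc n) f g rewrite sum0-+ n f g =
  solve 4 (λ a b c d → (a :+ b) :+ (c :+ d) := (a :+ c) :+ (b :+ d)) refl (sum0 n f) (sum0 n g) (f n) (g n)

sum0-*ˡ : ∀ n c (f : ℕ → ℚ) → sum0 n (λ j → c * f j) ≡ c * sum0 n f
sum0-*ˡ zero    c f = sym (ℚP.*-zeroʳ c)
sum0-*ˡ (suc n) c f rewrite sum0-*ˡ n c f = sym (ℚP.*-distribˡ-+ c (sum0 n f) (f n))

sum1≡sum0∘suc : ∀ n (f : ℕ → ℚ) → sum1 n f ≡ sum0 n (λ j → f (suc j))
sum1≡sum0∘suc zero    f = refl
sum1≡sum0∘suc (suc n) f = cong (_+ f (suc n)) (sum1≡sum0∘suc n f)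

sum0-suc≡f0+sum1 : ∀ n (f : ℕ → ℚ) → sum0 (suc n) f ≡ f 0 + sum1 n f
sum0-suc≡f0+sum1 zero    f = trans (ℚP.+-identityˡ (f 0)) (sym (ℚP.+-identityʳ (f 0)))
sum0-suc≡f0+sum1 (suc n) f = trans (cong (_+ f (suc n)) (sum0-suc≡f0+sum1 n f)) (ℚP.+-assoc (f 0) _ _)

sum0-reverse : ∀ n (f : ℕ → ℚ) → sum0 n f ≡ sum0 n (λ j → f (n ∸ suc j))
sum0-reverse zero    f = refl
sum0-reverse (suc n) f = begin
  sum0 (suc n) f                                      ≡⟨ sum0-suc≡f0+sum1 n f ⟩
  f 0 + sum1 n f                                      ≡⟨ cong (f 0 +_) (sum1≡sum0∘suc n f) ⟩
  f 0 + sum0 n (λ j → f (suc j))                      ≡⟨ cong (f 0 +_) (sum0-reverse n (λ j → f (suc j))) ⟩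
  f 0 + sum0 n (λ j → f (suc (n ∸ suc j)))            ≡⟨ cong (f 0 +_) (sum0-cong-< n (λ j j<n → cong f (ℕP.+-∸-assoc 1 j<n))) ⟨
  f 0 + sum0 n (λ j → f (suc n ∸ suc j))              ≡⟨ ℚP.+-comm (f 0) _ ⟩
  sum0 n (λ j → f (suc n ∸ suc j)) + f 0              ≡⟨ cong (λ k → sum0 n (λ j → f (suc n ∸ suc j)) + f k) (ℕP.n∸n≡0 n) ⟨
  sum0 (suc n) (λ j → f (suc n ∸ suc j))              ∎
  where open ≡-Reasoning

sum1-cong-< : ∀ n {f g : ℕ → ℚ} → (∀ i → i < n → f (suc i) ≡ g (suc i)) → sum1 n f ≡ sum1 n g
sum1-cong-< zero    f≡g = refl
sum1-cong-< (suc n) f≡g = cong₂ _+_ (sum1-cong-< n (λ i i<n → f≡g i (ℕP.m<n⇒m<1+n i<n))) (f≡g n ℕP.≤-refl)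

sum1-cong : ∀ n {f g : ℕ → ℚ} → (∀ i → f (suc i) ≡ g (suc i)) → sum1 n f ≡ sum1 n g
sum1-cong n f≡g = sum1-cong-< n (λ i _ → f≡g i)

sum1-+ : ∀ n (f g : ℕ → ℚ) → sum1 n (λ j → f j + g j) ≡ sum1 n f + sum1 n g
sum1-+ zero    f g = refl
sum1-+ (suc n) f g rewrite sum1-+ n f g =
  solve 4 (λ a b c d → (a :+ b) :+ (c :+ d) := (a :+ c) :+ (b :+ d)) refl (sum1 n f) (sum1 n g) (f (suc n)) (g (suc n))

sum1-*ˡ : ∀ n c (f : ℕ → ℚ) → sum1 n (λ j → c * f j) ≡ c * sum1 n f
sum1-*ˡ zero    c f = sym (ℚP.*-zeroʳ c)
sum1-*ˡ (suc n) c f rewrite sum1-*ˡ n c f = sym (ℚP.*-distribˡ-+ c (sum1 n f) (f (suc n)))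

-- Formal power series

Series : Set
Series = ℕ → ℚ

infix  4 _≈_
infixl 6 _⊕_
infixl 7 _⊛_
infix  8 ⊝_

_≈_ : Series → Series → Set
a ≈ b = ∀ n → a n ≡ b n

_⊕_ : Series → Series → Series
(a ⊕ b) n = a n + b n

⊝_ : Series → Series
(⊝ a) n = - a n

scalar : ℚ → Series
scalar c zero    = c
scalar c (suc _) = 0ℚ

𝟘 𝟙 X : Series
𝟘 _ = 0ℚ
𝟙 = scalar 1ℚ
X zero          = 0ℚ
X (suc zero)    = 1ℚ
X (suc (suc _)) = 0ℚ

_⊛_ : Series → Series → Series
(a ⊛ b) n = sum0 (suc n) (λ j → a j * b (n ∸ j))

tail : Series → Series
tail a j = a (suc j)

≈-refl : ∀ {a} → a ≈ a
≈-refl n = refl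

≈-sym : ∀ {a b} → a ≈ b → b ≈ a
≈-sym a≈b n = sym (a≈b n)

⊕-cong : ∀ {a a′ b b′} → a ≈ a′ → b ≈ b′ → a ⊕ b ≈ a′ ⊕ b′
⊕-cong a≈a′ b≈b′ n = cong₂ _+_ (a≈a′ n) (b≈b′ n)

⊛-cong : ∀ {a a′ b b′} → a ≈ a′ → b ≈ b′ → a ⊛ b ≈ a′ ⊛ b′
⊛-cong a≈a′ b≈b′ n = sum0-cong (suc n) (λ j → cong₂ _*_ (a≈a′ j) (b≈b′ (n ∸ j)))

⊛-congˡ : ∀ a {b b′} → b ≈ b′ → a ⊛ b ≈ a ⊛ b′
⊛-congˡ a = ⊛-cong {a = a} ≈-refl

⊛-congʳ : ∀ b {a a′} → a ≈ a′ → a ⊛ b ≈ a′ ⊛ b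
⊛-congʳ b a≈a′ = ⊛-cong {b = b} a≈a′ ≈-refl

⊛-coeff-zero : ∀ a b → (a ⊛ b) 0 ≡ a 0 * b 0
⊛-coeff-zero a b = ℚP.+-identityˡ _

⊛-coeff-suc : ∀ a b m → (a ⊛ b) (suc m) ≡ a 0 * b (suc m) + (tail a ⊛ b) m
⊛-coeff-suc a b m = trans (sum0-suc≡f0+sum1 (suc m) _) (cong (a 0 * b (suc m) +_) (sum1≡sum0∘suc (suc m) _))

⊛-coeff : ∀ a b n → (a ⊛ b) n ≡ a 0 * b n + sum1 n (λ j → a j * b (n ∸ j))
⊛-coeff a b n = sum0-suc≡f0+sum1 n _

⊛-distribˡ : ∀ a b c → a ⊛ (b ⊕ c) ≈ a ⊛ b ⊕ a ⊛ c
⊛-distribˡ a b c n =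
  trans (sum0-cong (suc n) (λ j → ℚP.*-distribˡ-+ (a j) (b (n ∸ j)) (c (n ∸ j)))) (sum0-+ (suc n) _ _)

⊛-distribʳ : ∀ a b c → (b ⊕ c) ⊛ a ≈ b ⊛ a ⊕ c ⊛ a
⊛-distribʳ a b c n =
  trans (sum0-cong (suc n) (λ j → ℚP.*-distribʳ-+ (a (n ∸ j)) (b j) (c j))) (sum0-+ (suc n) _ _)

⊛-*ˡ : ∀ x a b n → ((λ j → x * a j) ⊛ b) n ≡ x * (a ⊛ b) n
⊛-*ˡ x a b n =
  trans (sum0-cong (suc n) (λ j → ℚP.*-assoc x (a j) (b (n ∸ j)))) (sum0-*ˡ (suc n) x _)

⊛-zeroˡ : ∀ a → 𝟘 ⊛ a ≈ 𝟘
⊛-zeroˡ a n = trans (⊛-*ˡ 0ℚ 𝟘 a n) (ℚP.*-zeroˡ ((𝟘 ⊛ a) n))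

⊛-comm : ∀ a b → a ⊛ b ≈ b ⊛ a
⊛-comm a b n = trans (sum0-reverse (suc n) _) (sum0-cong-< (suc n) (λ j j≤n → begin
  a (n ∸ j) * b (n ∸ (n ∸ j))  ≡⟨ cong (λ k → a (n ∸ j) * b k) (ℕP.m∸[m∸n]≡n (ℕP.≤-pred j≤n)) ⟩
  a (n ∸ j) * b j              ≡⟨ ℚP.*-comm (a (n ∸ j)) (b j) ⟩
  b j * a (n ∸ j)              ∎))
  where open ≡-Reasoning

⊛-zeroʳ : ∀ a → a ⊛ 𝟘 ≈ 𝟘
⊛-zeroʳ a n = trans (⊛-comm a 𝟘 n) (⊛-zeroˡ a n)

⊛-identityˡ : ∀ a → 𝟙 ⊛ a ≈ a
⊛-identityˡ a zero    = trans (⊛-coeff-zero 𝟙 a) (ℚP.*-identityˡ (a 0))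
⊛-identityˡ a (suc m) = begin
  (𝟙 ⊛ a) (suc m)                ≡⟨ ⊛-coeff-suc 𝟙 a m ⟩
  1ℚ * a (suc m) + (𝟘 ⊛ a) m     ≡⟨ cong₂ _+_ (ℚP.*-identityˡ (a (suc m))) (⊛-zeroˡ a m) ⟩
  a (suc m) + 0ℚ                 ≡⟨ ℚP.+-identityʳ (a (suc m)) ⟩
  a (suc m)                      ∎
  where open ≡-Reasoning

⊛-assoc : ∀ a b c → (a ⊛ b) ⊛ c ≈ a ⊛ (b ⊛ c)
⊛-assoc a b c zero = begin
  ((a ⊛ b) ⊛ c) 0    ≡⟨ trans (⊛-coeff-zero (a ⊛ b) c) (cong (_* c 0) (⊛-coeff-zero a b)) ⟩
  a 0 * b 0 * c 0    ≡⟨ ℚP.*-assoc (a 0) (b 0) (c 0) ⟩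
  a 0 * (b 0 * c 0)  ≡⟨ trans (⊛-coeff-zero a (b ⊛ c)) (cong (a 0 *_) (⊛-coeff-zero b c)) ⟨
  (a ⊛ (b ⊛ c)) 0    ∎
  where open ≡-Reasoning
⊛-assoc a b c (suc k) = begin
  ((a ⊛ b) ⊛ c) (suc k)
    ≡⟨ ⊛-coeff-suc (a ⊛ b) c k ⟩
  (a ⊛ b) 0 * c (suc k) + (tail (a ⊛ b) ⊛ c) k
    ≡⟨ cong₂ _+_ (cong (_* c (suc k)) (⊛-coeff-zero a b)) (⊛-congʳ c (⊛-coeff-suc a b) k) ⟩
  a 0 * b 0 * c (suc k) + ((λ j → a 0 * tail b j + (tail a ⊛ b) j) ⊛ c) k
    ≡⟨ cong (a 0 * b 0 * c (suc k) +_) (⊛-distribʳ c (λ j → a 0 * tail b j) (tail a ⊛ b) k) ⟩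
  a 0 * b 0 * c (suc k) + (((λ j → a 0 * tail b j) ⊛ c) k + ((tail a ⊛ b) ⊛ c) k)
    ≡⟨ cong₂ (λ u v → a 0 * b 0 * c (suc k) + (u + v)) (⊛-*ˡ (a 0) (tail b) c k) (⊛-assoc (tail a) b c k) ⟩
  a 0 * b 0 * c (suc k) + (a 0 * (tail b ⊛ c) k + (tail a ⊛ (b ⊛ c)) k)
    ≡⟨ regroup (a 0) (b 0) (c (suc k)) ((tail b ⊛ c) k) ((tail a ⊛ (b ⊛ c)) k) ⟩
  a 0 * (b 0 * c (suc k) + (tail b ⊛ c) k) + (tail a ⊛ (b ⊛ c)) k
    ≡⟨ cong (λ z → a 0 * z + (tail a ⊛ (b ⊛ c)) k) (⊛-coeff-suc b c k) ⟨
  a 0 * (b ⊛ c) (suc k) + (tail a ⊛ (b ⊛ c)) k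
    ≡⟨ ⊛-coeff-suc a (b ⊛ c) k ⟨
  (a ⊛ (b ⊛ c)) (suc k)
    ∎
  where
  open ≡-Reasoning
  regroup : ∀ x y z u v → x * y * z + (x * u + v) ≡ x * (y * z + u) + v
  regroup = solve 5 (λ x y z u v → x :* y :* z :+ (x :* u :+ v) := x :* (y :* z :+ u) :+ v) refl

seriesRing : CommutativeRing _ _
seriesRing = record
  { Carrier = Series ; _≈_ = _≈_ ; _+_ = _⊕_ ; _*_ = _⊛_ ; -_ = ⊝_ ; 0# = 𝟘 ; 1# = 𝟙
  ; isCommutativeRing = record
    { isRing = record
      { +-isAbelianGroup = ⊕-isAbelianGroup
      ; *-cong           = ⊛-cong
      ; *-assoc          = ⊛-assoc
      ; *-identity       = ⊛-identityˡ , λ a n → trans (⊛-comm a 𝟙 n) (⊛-identityˡ a n)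
      ; distrib          = ⊛-distribˡ , ⊛-distribʳ
      }
    ; *-comm = ⊛-comm
    }
  }
  where
  ≈-isEquivalence : IsEquivalence _≈_
  ≈-isEquivalence = record { refl = ≈-refl ; sym = ≈-sym ; trans = λ a≈b b≈c n → trans (a≈b n) (b≈c n) }
  ⊕-isAbelianGroup : IsAbelianGroup _≈_ _⊕_ 𝟘 ⊝_
  ⊕-isAbelianGroup = record
    { isGroup = record
      { isMonoid = record
        { isSemigroup = record
          { isMagma = record { isEquivalence = ≈-isEquivalence ; ∙-cong = ⊕-cong }
          ; assoc   = λ a b c n → ℚP.+-assoc (a n) (b n) (c n)
          }
        ; identity = (λ a n → ℚP.+-identityˡ (a n)) , (λ a n → ℚP.+-identityʳ (a n))
        }
      ; inverse = (λ a n → ℚP.+-inverseˡ (a n)) , (λ a n → ℚP.+-inverseʳ (a n))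
      ; ⁻¹-cong = λ a≈b n → cong -_ (a≈b n)
      }
    ; comm = λ a b n → ℚP.+-comm (a n) (b n)
    }

scalar-⊛ : ∀ c a n → (scalar c ⊛ a) n ≡ c * a n
scalar-⊛ c a zero    = ⊛-coeff-zero (scalar c) a
scalar-⊛ c a (suc m) = begin
  (scalar c ⊛ a) (suc m)          ≡⟨ ⊛-coeff-suc (scalar c) a m ⟩
  c * a (suc m) + (𝟘 ⊛ a) m       ≡⟨ cong (c * a (suc m) +_) (⊛-zeroˡ a m) ⟩
  c * a (suc m) + 0ℚ              ≡⟨ ℚP.+-identityʳ _ ⟩
  c * a (suc m)                   ∎
  where open ≡-Reasoning

scalarMorphism : ACR._-Raw-AlmostCommutative⟶_ ℚP.+-*-rawRing (ACR.fromCommutativeRing seriesRing)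
scalarMorphism = record
  { ⟦_⟧    = scalar
  ; +-homo = λ c d → λ { zero → refl ; (suc _) → refl }
  ; *-homo = λ c d n → sym (trans (scalar-⊛ c (scalar d) n) (*-homo c d n))
  ; -‿homo = λ c → λ { zero → refl ; (suc _) → refl }
  ; 0-homo = λ { zero → refl ; (suc _) → refl }
  ; 1-homo = λ { zero → refl ; (suc _) → refl }
  }
  where
  *-homo : ∀ c d n → c * scalar d n ≡ scalar (c * d) n
  *-homo c d zero    = refl
  *-homo c d (suc _) = ℚP.*-zeroʳ c

scalar-≟ : ∀ c d → Maybe (scalar c ≈ scalar d)
scalar-≟ c d with c ℚP.≟ d
... | yes refl = just ≈-refl
... | no _     = nothing

open import Algebra.Solver.Ring ℚP.+-*-rawRing (ACR.fromCommutativeRing seriesRing) scalarMorphism scalar-≟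
  using () renaming (solve to ⊛-solve; _:=_ to _≐_; _:+_ to _⊞_; _:*_ to _⊠_; :-_ to ⊖_; con to kon)

module ≈-Reasoning = SetoidReasoning (CommutativeRing.setoid seriesRing)

X⊛-coeff-zero : ∀ a → (X ⊛ a) 0 ≡ 0ℚ
X⊛-coeff-zero a = trans (⊛-coeff-zero X a) (ℚP.*-zeroˡ (a 0))

X⊛-coeff-suc : ∀ a m → (X ⊛ a) (suc m) ≡ a m
X⊛-coeff-suc a m = begin
  (X ⊛ a) (suc m)                 ≡⟨ ⊛-coeff-suc X a m ⟩
  0ℚ * a (suc m) + (tail X ⊛ a) m ≡⟨ cong₂ _+_ (ℚP.*-zeroˡ (a (suc m))) (⊛-congʳ a tail-X≈𝟙 m) ⟩
  0ℚ + (𝟙 ⊛ a) m                  ≡⟨ trans (ℚP.+-identityˡ _) (⊛-identityˡ a m) ⟩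
  a m                             ∎
  where
  open ≡-Reasoning
  tail-X≈𝟙 : tail X ≈ 𝟙
  tail-X≈𝟙 zero    = refl
  tail-X≈𝟙 (suc _) = refl

θ : Series → Series
θ a n = ⟦ n ⟧ * a n

θ-⊛ : ∀ a b → θ (a ⊛ b) ≈ θ a ⊛ b ⊕ a ⊛ θ b
θ-⊛ a b n = begin
  ⟦ n ⟧ * sum0 (suc n) (λ j → a j * b (n ∸ j))
    ≡⟨ sum0-*ˡ (suc n) ⟦ n ⟧ _ ⟨
  sum0 (suc n) (λ j → ⟦ n ⟧ * (a j * b (n ∸ j)))
    ≡⟨ sum0-cong-< (suc n) (λ j j≤n → split j (ℕP.≤-pred j≤n)) ⟩
  sum0 (suc n) (λ j → ⟦ j ⟧ * a j * b (n ∸ j) + a j * (⟦ n ∸ j ⟧ * b (n ∸ j)))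
    ≡⟨ sum0-+ (suc n) _ _ ⟩
  (θ a ⊛ b ⊕ a ⊛ θ b) n
    ∎
  where
  open ≡-Reasoning
  split : ∀ j → j ≤ n → ⟦ n ⟧ * (a j * b (n ∸ j)) ≡ ⟦ j ⟧ * a j * b (n ∸ j) + a j * (⟦ n ∸ j ⟧ * b (n ∸ j))
  split j j≤n = begin
    ⟦ n ⟧ * (a j * b (n ∸ j))
      ≡⟨ cong (λ k → ⟦ k ⟧ * (a j * b (n ∸ j))) (ℕP.m+[n∸m]≡n j≤n) ⟨
    ⟦ j ℕ.+ (n ∸ j) ⟧ * (a j * b (n ∸ j))
      ≡⟨ cong (_* (a j * b (n ∸ j))) (⟦⟧-homo-+ j (n ∸ j)) ⟩
    (⟦ j ⟧ + ⟦ n ∸ j ⟧) * (a j * b (n ∸ j))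
      ≡⟨ solve 4 (λ x y u v → (x :+ y) :* (u :* v) := x :* u :* v :+ u :* (y :* v)) refl ⟦ j ⟧ ⟦ n ∸ j ⟧ (a j) (b (n ∸ j)) ⟩
    ⟦ j ⟧ * a j * b (n ∸ j) + a j * (⟦ n ∸ j ⟧ * b (n ∸ j))
      ∎

-- A first-order differential equation

-- Coefficientwise form of the differential equation  θ s = a X θ s + b X s + X f,  where θ = x d/dx.
record Solves (a b : ℚ) (f s : Series) : Set where
  constructor solves
  field recurrence : ∀ m → ⟦ suc m ⟧ * s (suc m) ≡ a * (⟦ m ⟧ * s m) + b * s m + f m
open Solves

odeRhs : ℚ → ℚ → Series → Series → Series
odeRhs a b f s = scalar a ⊛ (X ⊛ θ s) ⊕ scalar b ⊛ (X ⊛ s) ⊕ X ⊛ f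

odeRhs-coeff-suc : ∀ a b f s m → odeRhs a b f s (suc m) ≡ a * (⟦ m ⟧ * s m) + b * s m + f m
odeRhs-coeff-suc a b f s m = begin
  odeRhs a b f s (suc m)
    ≡⟨ cong₂ _+_ (cong₂ _+_ (scalar-⊛ a (X ⊛ θ s) (suc m)) (scalar-⊛ b (X ⊛ s) (suc m))) refl ⟩
  a * (X ⊛ θ s) (suc m) + b * (X ⊛ s) (suc m) + (X ⊛ f) (suc m)
    ≡⟨ cong₂ _+_ (cong₂ (λ u v → a * u + b * v) (X⊛-coeff-suc (θ s) m) (X⊛-coeff-suc s m)) (X⊛-coeff-suc f m) ⟩
  a * (⟦ m ⟧ * s m) + b * s m + f m
    ∎
  where open ≡-Reasoning

odeRhs-coeff-zero : ∀ a b f s → odeRhs a b f s 0 ≡ 0ℚ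
odeRhs-coeff-zero a b f s = begin
  odeRhs a b f s 0
    ≡⟨ cong₂ _+_ (cong₂ _+_ (scalar-⊛ a (X ⊛ θ s) 0) (scalar-⊛ b (X ⊛ s) 0)) (X⊛-coeff-zero f) ⟩
  a * (X ⊛ θ s) 0 + b * (X ⊛ s) 0 + 0ℚ
    ≡⟨ cong₂ (λ u v → a * u + b * v + 0ℚ) (X⊛-coeff-zero (θ s)) (X⊛-coeff-zero s) ⟩
  a * 0ℚ + b * 0ℚ + 0ℚ
    ≡⟨ solve 2 (λ a b → a :* con 0ℚ :+ b :* con 0ℚ :+ con 0ℚ := con 0ℚ) refl a b ⟩
  0ℚ
    ∎
  where open ≡-Reasoning

Solves⇒θ≈odeRhs : ∀ {a b f s} → Solves a b f s → θ s ≈ odeRhs a b f s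
Solves⇒θ≈odeRhs {a} {b} {f} {s} sol zero    = trans (ℚP.*-zeroˡ (s 0)) (sym (odeRhs-coeff-zero a b f s))
Solves⇒θ≈odeRhs {a} {b} {f} {s} sol (suc m) = trans (recurrence sol m) (sym (odeRhs-coeff-suc a b f s m))

θ≈odeRhs⇒Solves : ∀ {a b f s} → θ s ≈ odeRhs a b f s → Solves a b f s
θ≈odeRhs⇒Solves {a} {b} {f} {s} eq = solves λ m → trans (eq (suc m)) (odeRhs-coeff-suc a b f s m)

Solves-⊛ : ∀ {a b c f g s t} → Solves a b f s → Solves a c g t → Solves a (b + c) (f ⊛ t ⊕ s ⊛ g) (s ⊛ t)
Solves-⊛ {a} {b} {c} {f} {g} {s} {t} sol-s sol-t = θ≈odeRhs⇒Solves (begin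
  θ (s ⊛ t)
    ≈⟨ θ-⊛ s t ⟩
  θ s ⊛ t ⊕ s ⊛ θ t
    ≈⟨ ⊕-cong (⊛-congʳ t (Solves⇒θ≈odeRhs sol-s)) (⊛-congˡ s (Solves⇒θ≈odeRhs sol-t)) ⟩
  odeRhs a b f s ⊛ t ⊕ s ⊛ odeRhs a c g t
    ≈⟨ ⊛-solve 10 (λ A B C X θs θt s t f g →
         (A ⊠ (X ⊠ θs) ⊞ B ⊠ (X ⊠ s) ⊞ X ⊠ f) ⊠ t ⊞ s ⊠ (A ⊠ (X ⊠ θt) ⊞ C ⊠ (X ⊠ t) ⊞ X ⊠ g)
         ≐ A ⊠ (X ⊠ (θs ⊠ t ⊞ s ⊠ θt)) ⊞ (B ⊞ C) ⊠ (X ⊠ (s ⊠ t)) ⊞ X ⊠ (f ⊠ t ⊞ s ⊠ g))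
         ≈-refl (scalar a) (scalar b) (scalar c) X (θ s) (θ t) s t f g ⟩
  scalar a ⊛ (X ⊛ (θ s ⊛ t ⊕ s ⊛ θ t)) ⊕ (scalar b ⊕ scalar c) ⊛ (X ⊛ (s ⊛ t)) ⊕ X ⊛ (f ⊛ t ⊕ s ⊛ g)
    ≈⟨ ⊕-cong (⊕-cong (⊛-congˡ (scalar a) (⊛-congˡ X (≈-sym (θ-⊛ s t)))) (⊛-congʳ (X ⊛ (s ⊛ t)) scalar-+)) ≈-refl ⟩
  odeRhs a (b + c) (f ⊛ t ⊕ s ⊛ g) (s ⊛ t)
    ∎)
  where
  open ≈-Reasoning
  scalar-+ : scalar b ⊕ scalar c ≈ scalar (b + c)
  scalar-+ zero    = refl
  scalar-+ (suc _) = refl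

Solves-scale : ∀ {a b f s} c → Solves a b f s → Solves a b (scalar c ⊛ f) (scalar c ⊛ s)
Solves-scale {a} {b} {f} {s} c sol = solves λ m → begin
  ⟦ suc m ⟧ * (scalar c ⊛ s) (suc m)
    ≡⟨ cong (⟦ suc m ⟧ *_) (scalar-⊛ c s (suc m)) ⟩
  ⟦ suc m ⟧ * (c * s (suc m))
    ≡⟨ solve 3 (λ k c x → k :* (c :* x) := c :* (k :* x)) refl ⟦ suc m ⟧ c (s (suc m)) ⟩
  c * (⟦ suc m ⟧ * s (suc m))
    ≡⟨ cong (c *_) (recurrence sol m) ⟩
  c * (a * (⟦ m ⟧ * s m) + b * s m + f m)
    ≡⟨ solve 6 (λ c a b k x y → c :* (a :* (k :* x) :+ b :* x :+ y) := a :* (k :* (c :* x)) :+ b :* (c :* x) :+ c :* y)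
         refl c a b ⟦ m ⟧ (s m) (f m) ⟩
  a * (⟦ m ⟧ * (c * s m)) + b * (c * s m) + c * f m
    ≡⟨ sym (cong₂ (λ u v → a * (⟦ m ⟧ * u) + b * u + v) (scalar-⊛ c s m) (scalar-⊛ c f m)) ⟩
  a * (⟦ m ⟧ * (scalar c ⊛ s) m) + b * (scalar c ⊛ s) m + (scalar c ⊛ f) m
    ∎
  where open ≡-Reasoning

Solves-unique : ∀ {a b f g s t} → Solves a b f s → Solves a b g t → f ≈ g → s 0 ≡ t 0 → s ≈ t
Solves-unique sol-s sol-t f≈g s₀≡t₀ zero    = s₀≡t₀
Solves-unique {a} {b} {f} {g} {s} {t} sol-s sol-t f≈g s₀≡t₀ (suc m) = ⟦1+k⟧*-cancelˡ m (begin
  ⟦ suc m ⟧ * s (suc m)              ≡⟨ recurrence sol-s m ⟩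
  a * (⟦ m ⟧ * s m) + b * s m + f m  ≡⟨ cong₂ (λ u v → a * (⟦ m ⟧ * u) + b * u + v) s≈t (f≈g m) ⟩
  a * (⟦ m ⟧ * t m) + b * t m + g m  ≡⟨ recurrence sol-t m ⟨
  ⟦ suc m ⟧ * t (suc m)              ∎)
  where
  open ≡-Reasoning
  s≈t = Solves-unique sol-s sol-t f≈g s₀≡t₀ m

-- s = t + 4 x s, that is s = t / (1-4x).
≈pow4⊛ : ∀ s t → s 0 ≡ t 0 → (∀ m → s (suc m) ≡ t (suc m) + ⟦ 4 ⟧ * s m) → s ≈ pow4 ⊛ t
≈pow4⊛ s t s₀≡t₀ rec zero    = trans s₀≡t₀ (trans (sym (ℚP.*-identityˡ (t 0))) (sym (⊛-coeff-zero pow4 t)))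
≈pow4⊛ s t s₀≡t₀ rec (suc m) = begin
  s (suc m)                                  ≡⟨ rec m ⟩
  t (suc m) + ⟦ 4 ⟧ * s m                    ≡⟨ cong₂ _+_ (sym (ℚP.*-identityˡ (t (suc m)))) (cong (⟦ 4 ⟧ *_) (≈pow4⊛ s t s₀≡t₀ rec m)) ⟩
  pow4 0 * t (suc m) + ⟦ 4 ⟧ * (pow4 ⊛ t) m  ≡⟨ cong (pow4 0 * t (suc m) +_) (⊛-*ˡ ⟦ 4 ⟧ pow4 t m) ⟨
  pow4 0 * t (suc m) + ((λ j → ⟦ 4 ⟧ * pow4 j) ⊛ t) m
                                             ≡⟨ cong (pow4 0 * t (suc m) +_) (⊛-congʳ t (λ j → sym (pow4-suc j)) m) ⟩
  pow4 0 * t (suc m) + (tail pow4 ⊛ t) m     ≡⟨ ⊛-coeff-suc pow4 t m ⟨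
  (pow4 ⊛ t) (suc m)                         ∎
  where open ≡-Reasoning

-- The generating functions, with x the formal variable:
--   β = (1-4x)^(-1/2),  pow4 = (1-4x)^(-1),  W = (1-4x)^(1/2) = 1 - 2κ  where κ = x C(x),
--   ℓ = -log(1-4x),  ω = ½ β ℓ,  η = pow4 ℓ,  σ = η ℓ,  ε q = (1-4x)^(-q-1),  α p = ℓ (ε p).
β κ W ℓ ω η σ : Series
β n = binom (2 ℕ.* n) n
κ zero    = 0ℚ
κ (suc m) = Cat m
W = 𝟙 ⊕ scalar (- ⟦ 2 ⟧) ⊛ κ
ℓ n = pow4 n * recip n
ω n = β n * O n
η n = pow4 n * H n
σ = η ⊛ ℓ

ε : ℕ → Series
ε q j = binom (q ℕ.+ j) j * pow4 j

α : ℕ → Series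
α p n = pow4 n * binom (n ℕ.+ p) n * (H (n ℕ.+ p) - H p)

β-recurrence : ∀ m → ⟦ suc m ⟧ * β (suc m) ≡ (⟦ 4 ⟧ * ⟦ m ⟧ + ⟦ 2 ⟧) * β m
β-recurrence m = begin
  ⟦ suc m ⟧ * β (suc m)                             ≡⟨ ⟦⟧-homo-* (suc m) ((2 ℕ.* suc m) C suc m) ⟨
  ⟦ suc m ℕ.* ((2 ℕ.* suc m) C suc m) ⟧              ≡⟨ cong ⟦_⟧ ([1+m]*[2+2m]C[1+m]≡2[1+2m]*[2m]Cm m) ⟩
  ⟦ 2 ℕ.* suc (2 ℕ.* m) ℕ.* ((2 ℕ.* m) C m) ⟧        ≡⟨ ⟦⟧-homo-* (2 ℕ.* suc (2 ℕ.* m)) ((2 ℕ.* m) C m) ⟩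
  ⟦ 2 ℕ.* suc (2 ℕ.* m) ⟧ * β m                     ≡⟨ cong (λ k → ⟦ k ⟧ * β m) (2[1+2m]≡4m+2 m) ⟩
  ⟦ 4 ℕ.* m ℕ.+ 2 ⟧ * β m                           ≡⟨ cong (_* β m) (trans (⟦⟧-homo-+ (4 ℕ.* m) 2) (cong (_+ ⟦ 2 ⟧) (⟦⟧-homo-* 4 m))) ⟩
  (⟦ 4 ⟧ * ⟦ m ⟧ + ⟦ 2 ⟧) * β m                     ∎
  where
  open ≡-Reasoning
  2[1+2m]≡4m+2 : ∀ m → 2 ℕ.* suc (2 ℕ.* m) ≡ 4 ℕ.* m ℕ.+ 2
  2[1+2m]≡4m+2 = solve-∀

β-Solves : Solves ⟦ 4 ⟧ ⟦ 2 ⟧ 𝟘 β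
β-Solves = solves λ m → trans (β-recurrence m)
  (solve 2 (λ k b → (con ⟦ 4 ⟧ :* k :+ con ⟦ 2 ⟧) :* b := con ⟦ 4 ⟧ :* (k :* b) :+ con ⟦ 2 ⟧ :* b :+ con 0ℚ) refl ⟦ m ⟧ (β m))

pow4-Solves : Solves ⟦ 4 ⟧ ⟦ 4 ⟧ 𝟘 pow4
pow4-Solves = solves λ m → begin
  ⟦ suc m ⟧ * pow4 (suc m)                         ≡⟨ cong₂ _*_ (⟦⟧-homo-+ 1 m) (pow4-suc m) ⟩
  (1ℚ + ⟦ m ⟧) * (⟦ 4 ⟧ * pow4 m)                  ≡⟨ solve 2 (λ k p → (con 1ℚ :+ k) :* (con ⟦ 4 ⟧ :* p) := con ⟦ 4 ⟧ :* (k :* p) :+ con ⟦ 4 ⟧ :* p :+ con 0ℚ) refl ⟦ m ⟧ (pow4 m) ⟩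
  ⟦ 4 ⟧ * (⟦ m ⟧ * pow4 m) + ⟦ 4 ⟧ * pow4 m + 0ℚ   ∎
  where open ≡-Reasoning

β⊛β≈pow4 : β ⊛ β ≈ pow4
β⊛β≈pow4 = Solves-unique (Solves-⊛ β-Solves β-Solves) pow4-Solves
  (λ n → cong₂ _+_ (⊛-zeroˡ β n) (⊛-zeroʳ β n)) refl

[1+k]*Cat≡β : ∀ k → ⟦ suc k ⟧ * Cat k ≡ β k
[1+k]*Cat≡β k = trans (cong (⟦ suc k ⟧ *_) (/suc≡*inv-suc ((2 ℕ.* k) C k) k)) (⟦1+k⟧*[x*inv-suc]≡x k (β k))

Cat-recurrence : ∀ k → ⟦ suc (suc k) ⟧ * Cat (suc k) ≡ (⟦ 4 ⟧ * ⟦ k ⟧ + ⟦ 2 ⟧) * Cat k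
Cat-recurrence k = begin
  ⟦ suc (suc k) ⟧ * Cat (suc k)  ≡⟨ [1+k]*Cat≡β (suc k) ⟩
  β (suc k)                      ≡⟨ ⟦1+k⟧*-cancelˡ k (begin
      ⟦ suc k ⟧ * β (suc k)          ≡⟨ β-recurrence k ⟩
      c * β k                        ≡⟨ cong (c *_) ([1+k]*Cat≡β k) ⟨
      c * (⟦ suc k ⟧ * Cat k)        ≡⟨ solve 3 (λ x y z → x :* (y :* z) := y :* (x :* z)) refl c ⟦ suc k ⟧ (Cat k) ⟩
      ⟦ suc k ⟧ * (c * Cat k)        ∎) ⟩
  c * Cat k                      ∎
  where
  open ≡-Reasoning
  c = ⟦ 4 ⟧ * ⟦ k ⟧ + ⟦ 2 ⟧

W-coeff-suc : ∀ k → W (suc k) ≡ - ⟦ 2 ⟧ * Cat k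
W-coeff-suc k = trans (cong (0ℚ +_) (scalar-⊛ (- ⟦ 2 ⟧) κ (suc k))) (ℚP.+-identityˡ _)

W-Solves : Solves ⟦ 4 ⟧ (- ⟦ 2 ⟧) 𝟘 W
W-Solves = solves λ where
  zero    → refl
  (suc k) → let open ≡-Reasoning in begin
    ⟦ suc (suc k) ⟧ * W (suc (suc k))
      ≡⟨ cong (⟦ suc (suc k) ⟧ *_) (W-coeff-suc (suc k)) ⟩
    ⟦ suc (suc k) ⟧ * (- ⟦ 2 ⟧ * Cat (suc k))
      ≡⟨ solve 2 (λ a c → a :* (con (- ⟦ 2 ⟧) :* c) := con (- ⟦ 2 ⟧) :* (a :* c)) refl ⟦ suc (suc k) ⟧ (Cat (suc k)) ⟩
    - ⟦ 2 ⟧ * (⟦ suc (suc k) ⟧ * Cat (suc k))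
      ≡⟨ cong (- ⟦ 2 ⟧ *_) (Cat-recurrence k) ⟩
    - ⟦ 2 ⟧ * ((⟦ 4 ⟧ * ⟦ k ⟧ + ⟦ 2 ⟧) * Cat k)
      ≡⟨ solve 2 (λ x c → con (- ⟦ 2 ⟧) :* ((con ⟦ 4 ⟧ :* x :+ con ⟦ 2 ⟧) :* c)
                       := con ⟦ 4 ⟧ :* ((con 1ℚ :+ x) :* (con (- ⟦ 2 ⟧) :* c)) :+ con (- ⟦ 2 ⟧) :* (con (- ⟦ 2 ⟧) :* c) :+ con 0ℚ)
           refl ⟦ k ⟧ (Cat k) ⟩
    ⟦ 4 ⟧ * ((1ℚ + ⟦ k ⟧) * (- ⟦ 2 ⟧ * Cat k)) + - ⟦ 2 ⟧ * (- ⟦ 2 ⟧ * Cat k) + 0ℚ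
      ≡⟨ cong₂ (λ u v → ⟦ 4 ⟧ * (u * v) + - ⟦ 2 ⟧ * v + 0ℚ) (⟦⟧-homo-+ 1 k) (W-coeff-suc k) ⟨
    ⟦ 4 ⟧ * (⟦ suc k ⟧ * W (suc k)) + - ⟦ 2 ⟧ * W (suc k) + 0ℚ
      ∎

𝟙-Solves : Solves ⟦ 4 ⟧ 0ℚ 𝟘 𝟙
𝟙-Solves = solves λ where
  zero    → refl
  (suc k) → solve 2 (λ a b → a :* con 0ℚ := con ⟦ 4 ⟧ :* (b :* con 0ℚ) :+ con 0ℚ :* con 0ℚ :+ con 0ℚ) refl ⟦ suc (suc k) ⟧ ⟦ suc k ⟧

β⊛W≈𝟙 : β ⊛ W ≈ 𝟙
β⊛W≈𝟙 = Solves-unique (Solves-⊛ β-Solves W-Solves) 𝟙-Solves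
  (λ n → cong₂ _+_ (⊛-zeroˡ W n) (⊛-zeroʳ β n)) refl

ℓ-Solves : Solves ⟦ 4 ⟧ 0ℚ (scalar ⟦ 4 ⟧) ℓ
ℓ-Solves = solves λ where
  zero    → refl
  (suc k) → let open ≡-Reasoning in begin
    ⟦ suc (suc k) ⟧ * (pow4 (suc (suc k)) * inv-suc (suc k))
      ≡⟨ ⟦1+k⟧*[x*inv-suc]≡x (suc k) (pow4 (suc (suc k))) ⟩
    pow4 (suc (suc k))
      ≡⟨ pow4-suc (suc k) ⟩
    ⟦ 4 ⟧ * pow4 (suc k)
      ≡⟨ solve 2 (λ p l → con ⟦ 4 ⟧ :* p := con ⟦ 4 ⟧ :* p :+ con 0ℚ :* l :+ con 0ℚ) refl (pow4 (suc k)) (ℓ (suc k)) ⟩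
    ⟦ 4 ⟧ * pow4 (suc k) + 0ℚ * ℓ (suc k) + 0ℚ
      ≡⟨ cong (λ z → ⟦ 4 ⟧ * z + 0ℚ * ℓ (suc k) + 0ℚ) (⟦1+k⟧*[x*inv-suc]≡x k (pow4 (suc k))) ⟨
    ⟦ 4 ⟧ * (⟦ suc k ⟧ * ℓ (suc k)) + 0ℚ * ℓ (suc k) + 0ℚ
      ∎

ω-recurrence : ∀ m → ⟦ suc m ⟧ * ω (suc m) ≡ ⟦ 4 ⟧ * (⟦ m ⟧ * ω m) + ⟦ 2 ⟧ * ω m + (scalar ⟦ 2 ⟧ ⊛ β) m
ω-recurrence m = begin
  ⟦ suc m ⟧ * (β (suc m) * (O m + recip (2 ℕ.* suc m ∸ 1)))
    ≡⟨ cong (λ k → ⟦ suc m ⟧ * (β (suc m) * (O m + recip (k ∸ 1)))) (2[1+m]≡2+2m m) ⟩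
  ⟦ suc m ⟧ * (β (suc m) * (O m + r))
    ≡⟨ ℚP.*-assoc ⟦ suc m ⟧ (β (suc m)) _ ⟨
  ⟦ suc m ⟧ * β (suc m) * (O m + r)
    ≡⟨ cong (_* (O m + r)) (β-recurrence m) ⟩
  (⟦ 4 ⟧ * ⟦ m ⟧ + ⟦ 2 ⟧) * β m * (O m + r)
    ≡⟨ solve 4 (λ k b o r → (con ⟦ 4 ⟧ :* k :+ con ⟦ 2 ⟧) :* b :* (o :+ r) :=
          con ⟦ 4 ⟧ :* (k :* (b :* o)) :+ con ⟦ 2 ⟧ :* (b :* o) :+ con ⟦ 2 ⟧ :* b :* ((con 1ℚ :+ con ⟦ 2 ⟧ :* k) :* r))
         refl ⟦ m ⟧ (β m) (O m) r ⟩
  ⟦ 4 ⟧ * (⟦ m ⟧ * ω m) + ⟦ 2 ⟧ * ω m + ⟦ 2 ⟧ * β m * ((1ℚ + ⟦ 2 ⟧ * ⟦ m ⟧) * r)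
    ≡⟨ cong (λ z → ⟦ 4 ⟧ * (⟦ m ⟧ * ω m) + ⟦ 2 ⟧ * ω m + ⟦ 2 ⟧ * β m * (z * r)) ⟦1+2m⟧ ⟨
  ⟦ 4 ⟧ * (⟦ m ⟧ * ω m) + ⟦ 2 ⟧ * ω m + ⟦ 2 ⟧ * β m * (⟦ suc (2 ℕ.* m) ⟧ * r)
    ≡⟨ cong (λ z → ⟦ 4 ⟧ * (⟦ m ⟧ * ω m) + ⟦ 2 ⟧ * ω m + ⟦ 2 ⟧ * β m * z) (⟦1+k⟧*inv-suc≡1 (2 ℕ.* m)) ⟩
  ⟦ 4 ⟧ * (⟦ m ⟧ * ω m) + ⟦ 2 ⟧ * ω m + ⟦ 2 ⟧ * β m * 1ℚ
    ≡⟨ cong (⟦ 4 ⟧ * (⟦ m ⟧ * ω m) + ⟦ 2 ⟧ * ω m +_) (trans (ℚP.*-identityʳ _) (sym (scalar-⊛ ⟦ 2 ⟧ β m))) ⟩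
  ⟦ 4 ⟧ * (⟦ m ⟧ * ω m) + ⟦ 2 ⟧ * ω m + (scalar ⟦ 2 ⟧ ⊛ β) m
    ∎
  where
  open ≡-Reasoning
  r = inv-suc (2 ℕ.* m)
  ⟦1+2m⟧ : ⟦ suc (2 ℕ.* m) ⟧ ≡ 1ℚ + ⟦ 2 ⟧ * ⟦ m ⟧
  ⟦1+2m⟧ = trans (⟦⟧-homo-+ 1 (2 ℕ.* m)) (cong (1ℚ +_) (⟦⟧-homo-* 2 m))

ω-Solves : Solves ⟦ 4 ⟧ ⟦ 2 ⟧ (scalar ⟦ 2 ⟧ ⊛ β) ω
ω-Solves = solves ω-recurrence

ω≈½β⊛ℓ : ω ≈ scalar ½ ⊛ (β ⊛ ℓ)
ω≈½β⊛ℓ = Solves-unique ω-Solves (Solves-scale ½ (Solves-⊛ β-Solves ℓ-Solves)) ½[𝟘⊛ℓ⊕β⊛4]≈2β refl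
  where
  ½[𝟘⊛ℓ⊕β⊛4]≈2β : scalar ⟦ 2 ⟧ ⊛ β ≈ scalar ½ ⊛ (𝟘 ⊛ ℓ ⊕ β ⊛ scalar ⟦ 4 ⟧)
  ½[𝟘⊛ℓ⊕β⊛4]≈2β n = begin
    (scalar ⟦ 2 ⟧ ⊛ β) n                             ≡⟨ scalar-⊛ ⟦ 2 ⟧ β n ⟩
    ⟦ 2 ⟧ * β n                                      ≡⟨ solve 1 (λ b → con ⟦ 2 ⟧ :* b := con ½ :* (con 0ℚ :+ con ⟦ 4 ⟧ :* b)) refl (β n) ⟩
    ½ * (0ℚ + ⟦ 4 ⟧ * β n)                           ≡⟨ cong₂ (λ u v → ½ * (u + v)) (⊛-zeroˡ ℓ n) (trans (⊛-comm β (scalar ⟦ 4 ⟧) n) (scalar-⊛ ⟦ 4 ⟧ β n)) ⟨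
    ½ * ((𝟘 ⊛ ℓ) n + (β ⊛ scalar ⟦ 4 ⟧) n)          ≡⟨ scalar-⊛ ½ (𝟘 ⊛ ℓ ⊕ β ⊛ scalar ⟦ 4 ⟧) n ⟨
    (scalar ½ ⊛ (𝟘 ⊛ ℓ ⊕ β ⊛ scalar ⟦ 4 ⟧)) n       ∎
    where open ≡-Reasoning

η≈pow4⊛ℓ : η ≈ pow4 ⊛ ℓ
η≈pow4⊛ℓ = ≈pow4⊛ η ℓ refl λ m → begin
  pow4 (suc m) * (H m + inv-suc m)                 ≡⟨ cong (_* (H m + inv-suc m)) (pow4-suc m) ⟩
  ⟦ 4 ⟧ * pow4 m * (H m + inv-suc m)               ≡⟨ solve 4 (λ c p h r → c :* p :* (h :+ r) := c :* p :* r :+ c :* (p :* h)) refl ⟦ 4 ⟧ (pow4 m) (H m) (inv-suc m) ⟩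
  ⟦ 4 ⟧ * pow4 m * inv-suc m + ⟦ 4 ⟧ * η m         ≡⟨ cong (λ z → z * inv-suc m + ⟦ 4 ⟧ * η m) (pow4-suc m) ⟨
  ℓ (suc m) + ⟦ 4 ⟧ * η m                          ∎
  where open ≡-Reasoning

ω≈½W⊛η : ω ≈ scalar ½ ⊛ (W ⊛ η)
ω≈½W⊛η = begin
  ω                                        ≈⟨ ω≈½β⊛ℓ ⟩
  scalar ½ ⊛ (β ⊛ ℓ)                       ≈⟨ ⊛-solve 2 (λ b l → kon ½ ⊠ (b ⊠ l) ≐ kon ½ ⊠ (b ⊠ l) ⊠ kon 1ℚ) ≈-refl β ℓ ⟩
  scalar ½ ⊛ (β ⊛ ℓ) ⊛ 𝟙                   ≈⟨ ⊛-congˡ (scalar ½ ⊛ (β ⊛ ℓ)) (≈-sym β⊛W≈𝟙) ⟩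
  scalar ½ ⊛ (β ⊛ ℓ) ⊛ (β ⊛ W)             ≈⟨ ⊛-solve 3 (λ b l w → kon ½ ⊠ (b ⊠ l) ⊠ (b ⊠ w) ≐ kon ½ ⊠ (w ⊠ ((b ⊠ b) ⊠ l))) ≈-refl β ℓ W ⟩
  scalar ½ ⊛ (W ⊛ ((β ⊛ β) ⊛ ℓ))           ≈⟨ ⊛-congˡ (scalar ½) (⊛-congˡ W (⊛-congʳ ℓ β⊛β≈pow4)) ⟩
  scalar ½ ⊛ (W ⊛ (pow4 ⊛ ℓ))              ≈⟨ ⊛-congˡ (scalar ½) (⊛-congˡ W (≈-sym η≈pow4⊛ℓ)) ⟩
  scalar ½ ⊛ (W ⊛ η)                       ∎
  where open ≈-Reasoning

⊛ω≈½W⊛η⊛ : ∀ a → a ⊛ ω ≈ scalar ½ ⊛ (W ⊛ (η ⊛ a))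
⊛ω≈½W⊛η⊛ a = begin
  a ⊛ ω                          ≈⟨ ⊛-congˡ a ω≈½W⊛η ⟩
  a ⊛ (scalar ½ ⊛ (W ⊛ η))       ≈⟨ ⊛-solve 3 (λ a w e → a ⊠ (kon ½ ⊠ (w ⊠ e)) ≐ kon ½ ⊠ (w ⊠ (e ⊠ a))) ≈-refl a W η ⟩
  scalar ½ ⊛ (W ⊛ (η ⊛ a))       ∎
  where open ≈-Reasoning

½W⊛-coeff : ∀ y n → (scalar ½ ⊛ (W ⊛ y)) n ≡ ½ * y n - (κ ⊛ y) n
½W⊛-coeff y n = begin
  (scalar ½ ⊛ (W ⊛ y)) n
    ≡⟨ ⊛-solve 2 (λ k y → kon ½ ⊠ ((kon 1ℚ ⊞ kon (- ⟦ 2 ⟧) ⊠ k) ⊠ y) ≐ kon ½ ⊠ y ⊞ ⊖ (k ⊠ y)) ≈-refl κ y n ⟩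
  (scalar ½ ⊛ y) n + - (κ ⊛ y) n
    ≡⟨ cong (_+ - (κ ⊛ y) n) (scalar-⊛ ½ y n) ⟩
  ½ * y n - (κ ⊛ y) n
    ∎
  where open ≡-Reasoning

⟦1+q⟧*[q+1+i]Ci≡⟦1+i⟧*[q+1+i]C[1+i] : ∀ q i →
  ⟦ suc q ⟧ * binom (q ℕ.+ suc i) i ≡ ⟦ suc i ⟧ * binom (q ℕ.+ suc i) (suc i)
⟦1+q⟧*[q+1+i]Ci≡⟦1+i⟧*[q+1+i]C[1+i] q i = begin
  ⟦ suc q ⟧ * binom (q ℕ.+ suc i) i            ≡⟨ ⟦⟧-homo-* (suc q) ((q ℕ.+ suc i) C i) ⟨
  ⟦ suc q ℕ.* ((q ℕ.+ suc i) C i) ⟧            ≡⟨ cong ⟦_⟧ ([1+q]*[q+1+i]Ci≡[1+i]*[q+1+i]C[1+i] q i) ⟩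
  ⟦ suc i ℕ.* ((q ℕ.+ suc i) C suc i) ⟧        ≡⟨ ⟦⟧-homo-* (suc i) ((q ℕ.+ suc i) C suc i) ⟩
  ⟦ suc i ⟧ * binom (q ℕ.+ suc i) (suc i)      ∎
  where open ≡-Reasoning

ε-coeff-zero : ∀ q → ε q 0 ≡ 1ℚ
ε-coeff-zero q = cong (λ k → ⟦ k ⟧ * pow4 0) (nC0≡1 (q ℕ.+ 0))

ε-zero : ε 0 ≈ pow4
ε-zero j = trans (cong (λ k → ⟦ k ⟧ * pow4 j) (nCn≡1 j)) (ℚP.*-identityˡ (pow4 j))

ε-suc-recurrence : ∀ q i → ε (suc q) (suc i) ≡ ε q (suc i) + ⟦ 4 ⟧ * ε (suc q) i
ε-suc-recurrence q i = begin
  ⟦ suc (q ℕ.+ suc i) C suc i ⟧ * pow4 (suc i)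
    ≡⟨ cong₂ _*_ (trans (cong ⟦_⟧ ([n+1]C[k+1]≡nCk+nC[k+1] (q ℕ.+ suc i) i)) (⟦⟧-homo-+ x y)) (pow4-suc i) ⟩
  (⟦ x ⟧ + ⟦ y ⟧) * (⟦ 4 ⟧ * pow4 i)
    ≡⟨ solve 4 (λ x y c p → (x :+ y) :* (c :* p) := y :* (c :* p) :+ c :* (x :* p)) refl ⟦ x ⟧ ⟦ y ⟧ ⟦ 4 ⟧ (pow4 i) ⟩
  ⟦ y ⟧ * (⟦ 4 ⟧ * pow4 i) + ⟦ 4 ⟧ * (⟦ x ⟧ * pow4 i)
    ≡⟨ cong₂ (λ u k → ⟦ y ⟧ * u + ⟦ 4 ⟧ * (⟦ k C i ⟧ * pow4 i)) (pow4-suc i) (sym (ℕP.+-suc q i)) ⟨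
  ε q (suc i) + ⟦ 4 ⟧ * ε (suc q) i
    ∎
  where
  open ≡-Reasoning
  x = (q ℕ.+ suc i) C i
  y = (q ℕ.+ suc i) C suc i

ε-suc : ∀ q → ε (suc q) ≈ pow4 ⊛ ε q
ε-suc q = ≈pow4⊛ (ε (suc q)) (ε q) (trans (ε-coeff-zero (suc q)) (sym (ε-coeff-zero q))) (ε-suc-recurrence q)

α-coeff-zero : ∀ p → α p 0 ≡ 0ℚ
α-coeff-zero p = trans (cong (pow4 0 * binom p 0 *_) (ℚP.+-inverseʳ (H p))) (ℚP.*-zeroʳ (pow4 0 * binom p 0))

α-zero : α 0 ≈ η
α-zero n = begin
  pow4 n * binom (n ℕ.+ 0) n * (H (n ℕ.+ 0) - 0ℚ)  ≡⟨ cong (λ k → pow4 n * binom k n * (H k - 0ℚ)) (ℕP.+-identityʳ n) ⟩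
  pow4 n * ⟦ n C n ⟧ * (H n - 0ℚ)                 ≡⟨ cong (λ k → pow4 n * ⟦ k ⟧ * (H n - 0ℚ)) (nCn≡1 n) ⟩
  pow4 n * 1ℚ * (H n - 0ℚ)                        ≡⟨ solve 2 (λ p h → p :* con 1ℚ :* (h :- con 0ℚ) := p :* h) refl (pow4 n) (H n) ⟩
  pow4 n * H n                                    ∎
  where open ≡-Reasoning

α-suc-recurrence : ∀ q a → α (suc q) (suc a) ≡ α q (suc a) + ⟦ 4 ⟧ * α (suc q) a
α-suc-recurrence q a = begin
  pow4 (suc a) * ⟦ suc M C suc a ⟧ * ((H M + rM) - (H q + rq))
    ≡⟨ cong₂ (λ u v → u * v * ((H M + rM) - (H q + rq))) (pow4-suc a) (trans (cong ⟦_⟧ ([n+1]C[k+1]≡nCk+nC[k+1] M a)) (⟦⟧-homo-+ (M C a) (M C suc a))) ⟩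
  ⟦ 4 ⟧ * p * (x + y) * ((H M + rM) - (H q + rq))
    ≡⟨ solve 8 (λ c p x y h r hq rq → c :* p :* (x :+ y) :* ((h :+ r) :- (hq :+ rq)) :=
                    c :* p :* ((x :+ y) :* (h :- hq) :+ (x :+ y) :* r :- (x :+ y) :* rq))
         refl ⟦ 4 ⟧ p x y (H M) rM (H q) rq ⟩
  ⟦ 4 ⟧ * p * ((x + y) * (H M - H q) + (x + y) * rM - (x + y) * rq)
    ≡⟨ cong (λ z → ⟦ 4 ⟧ * p * ((x + y) * (H M - H q) + z - (x + y) * rq)) [x+y]*rM≡y*rq ⟩
  ⟦ 4 ⟧ * p * ((x + y) * (H M - H q) + y * rq - (x + y) * rq)
    ≡⟨ solve 7 (λ c p x y h hq rq → c :* p :* ((x :+ y) :* (h :- hq) :+ y :* rq :- (x :+ y) :* rq) :=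
                    c :* p :* y :* (h :- hq) :+ c :* (p :* x :* (h :- (hq :+ rq))))
         refl ⟦ 4 ⟧ p x y (H M) (H q) rq ⟩
  ⟦ 4 ⟧ * p * y * (H M - H q) + ⟦ 4 ⟧ * α (suc q) a
    ≡⟨ cong₂ (λ u k → u * ⟦ k C suc a ⟧ * (H k - H q) + ⟦ 4 ⟧ * α (suc q) a) (pow4-suc a) (sym (ℕP.+-suc a q)) ⟨
  α q (suc a) + ⟦ 4 ⟧ * α (suc q) a
    ∎
  where
  open ≡-Reasoning
  M = a ℕ.+ suc q
  p = pow4 a
  x = ⟦ M C a ⟧
  y = ⟦ M C suc a ⟧
  rM = inv-suc M
  rq = inv-suc q
  q+[1+a]≡M : q ℕ.+ suc a ≡ M
  q+[1+a]≡M = trans (ℕP.+-comm q (suc a)) (sym (ℕP.+-suc a q))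
  absorption : ⟦ suc q ⟧ * x ≡ ⟦ suc a ⟧ * y
  absorption = subst (λ N → ⟦ suc q ⟧ * binom N a ≡ ⟦ suc a ⟧ * binom N (suc a)) q+[1+a]≡M
    (⟦1+q⟧*[q+1+i]Ci≡⟦1+i⟧*[q+1+i]C[1+i] q a)
  [x+y]*rM≡y*rq : (x + y) * rM ≡ y * rq
  [x+y]*rM≡y*rq = trans (*inv-suc-swap q M (begin
    ⟦ suc q ⟧ * (x + y)                ≡⟨ ℚP.*-distribˡ-+ ⟦ suc q ⟧ x y ⟩
    ⟦ suc q ⟧ * x + ⟦ suc q ⟧ * y      ≡⟨ cong (_+ ⟦ suc q ⟧ * y) absorption ⟩
    ⟦ suc a ⟧ * y + ⟦ suc q ⟧ * y      ≡⟨ ℚP.*-distribʳ-+ y ⟦ suc a ⟧ ⟦ suc q ⟧ ⟨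
    (⟦ suc a ⟧ + ⟦ suc q ⟧) * y        ≡⟨ cong (_* y) (⟦⟧-homo-+ (suc a) (suc q)) ⟨
    ⟦ suc M ⟧ * y                      ∎)) (ℚP.*-comm rq y)

α-suc : ∀ q → α (suc q) ≈ pow4 ⊛ α q
α-suc q = ≈pow4⊛ (α (suc q)) (α q) (trans (α-coeff-zero (suc q)) (sym (α-coeff-zero q))) (α-suc-recurrence q)

α≈ℓ⊛ε : ∀ p → α p ≈ ℓ ⊛ ε p
α≈ℓ⊛ε zero = begin
  α 0          ≈⟨ α-zero ⟩
  η            ≈⟨ η≈pow4⊛ℓ ⟩
  pow4 ⊛ ℓ     ≈⟨ ⊛-comm pow4 ℓ ⟩
  ℓ ⊛ pow4     ≈⟨ ⊛-congˡ ℓ (≈-sym ε-zero) ⟩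
  ℓ ⊛ ε 0      ∎
  where open ≈-Reasoning
α≈ℓ⊛ε (suc q) = begin
  α (suc q)             ≈⟨ α-suc q ⟩
  pow4 ⊛ α q            ≈⟨ ⊛-congˡ pow4 (α≈ℓ⊛ε q) ⟩
  pow4 ⊛ (ℓ ⊛ ε q)      ≈⟨ ⊛-solve 3 (λ g l e → g ⊠ (l ⊠ e) ≐ l ⊠ (g ⊠ e)) ≈-refl pow4 ℓ (ε q) ⟩
  ℓ ⊛ (pow4 ⊛ ε q)      ≈⟨ ⊛-congˡ ℓ (≈-sym (ε-suc q)) ⟩
  ℓ ⊛ ε (suc q)         ∎
  where open ≈-Reasoning

η⊛ε≈α : ∀ q → η ⊛ ε q ≈ α (suc q)
η⊛ε≈α q = begin
  η ⊛ ε q               ≈⟨ ⊛-congʳ (ε q) η≈pow4⊛ℓ ⟩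
  pow4 ⊛ ℓ ⊛ ε q        ≈⟨ ⊛-solve 3 (λ g l e → g ⊠ l ⊠ e ≐ l ⊠ (g ⊠ e)) ≈-refl pow4 ℓ (ε q) ⟩
  ℓ ⊛ (pow4 ⊛ ε q)      ≈⟨ ⊛-congˡ ℓ (≈-sym (ε-suc q)) ⟩
  ℓ ⊛ ε (suc q)         ≈⟨ ≈-sym (α≈ℓ⊛ε (suc q)) ⟩
  α (suc q)             ∎
  where open ≈-Reasoning

⊛-coeff-sum1 : ∀ a b n → a 0 ≡ 0ℚ → (a ⊛ b) n ≡ sum1 n (λ j → a j * b (n ∸ j))
⊛-coeff-sum1 a b n a₀≡0 = begin
  (a ⊛ b) n                                   ≡⟨ ⊛-coeff a b n ⟩
  a 0 * b n + sum1 n (λ j → a j * b (n ∸ j))  ≡⟨ cong (λ z → z * b n + sum1 n (λ j → a j * b (n ∸ j))) a₀≡0 ⟩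
  0ℚ * b n + sum1 n (λ j → a j * b (n ∸ j))   ≡⟨ cong (_+ sum1 n (λ j → a j * b (n ∸ j))) (ℚP.*-zeroˡ (b n)) ⟩
  0ℚ + sum1 n (λ j → a j * b (n ∸ j))         ≡⟨ ℚP.+-identityˡ _ ⟩
  sum1 n (λ j → a j * b (n ∸ j))              ∎
  where open ≡-Reasoning

n∸j∸1≡n∸[1+j] : ∀ n j → n ∸ j ∸ 1 ≡ n ∸ suc j
n∸j∸1≡n∸[1+j] n j = trans (ℕP.∸-+-assoc n j 1) (cong (n ∸_) (ℕP.+-comm j 1))

n∸[1+[n∸[1+j]]]≡j : ∀ {n j} → j < n → n ∸ suc (n ∸ suc j) ≡ j
n∸[1+[n∸[1+j]]]≡j (s≤s j≤m) = ℕP.m∸[m∸n]≡n j≤m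

κ⊛-coeff : ∀ y n → (κ ⊛ y) n ≡ sum0 n (λ j → Cat j * y (n ∸ suc j))
κ⊛-coeff y n = trans (⊛-coeff-sum1 κ y n refl) (sum1≡sum0∘suc n _)

κ⊛-coeff′ : ∀ y n → (κ ⊛ y) n ≡ sum0 n (λ i → y i * Cat (n ∸ suc i))
κ⊛-coeff′ y n = begin
  (κ ⊛ y) n                                                      ≡⟨ κ⊛-coeff y n ⟩
  sum0 n (λ j → Cat j * y (n ∸ suc j))                           ≡⟨ sum0-reverse n _ ⟩
  sum0 n (λ i → Cat (n ∸ suc i) * y (n ∸ suc (n ∸ suc i)))       ≡⟨ sum0-cong-< n (λ i i<n → begin
      Cat (n ∸ suc i) * y (n ∸ suc (n ∸ suc i))  ≡⟨ cong (λ k → Cat (n ∸ suc i) * y k) (n∸[1+[n∸[1+j]]]≡j i<n) ⟩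
      Cat (n ∸ suc i) * y i                      ≡⟨ ℚP.*-comm (Cat (n ∸ suc i)) (y i) ⟩
      y i * Cat (n ∸ suc i)                      ∎) ⟩
  sum0 n (λ i → y i * Cat (n ∸ suc i))                           ∎
  where open ≡-Reasoning

σ-coeff : ∀ n → σ n ≡ pow4 n * S n
σ-coeff n = begin
  (η ⊛ ℓ) n                                         ≡⟨ ⊛-comm η ℓ n ⟩
  (ℓ ⊛ η) n                                         ≡⟨ ⊛-coeff-sum1 ℓ η n refl ⟩
  sum1 n (λ j → ℓ j * η (n ∸ j))                    ≡⟨ sum1-cong-< n termwise ⟩
  sum1 n (λ j → pow4 n * (H (n ∸ j) * recip j))     ≡⟨ sum1-*ˡ n (pow4 n) _ ⟩
  pow4 n * S n                                      ∎
  where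
  open ≡-Reasoning
  termwise : ∀ i → i < n → ℓ (suc i) * η (n ∸ suc i) ≡ pow4 n * (H (n ∸ suc i) * recip (suc i))
  termwise i i<n = begin
    pow4 (suc i) * recip (suc i) * (pow4 (n ∸ suc i) * H (n ∸ suc i))
      ≡⟨ solve 4 (λ p r q h → p :* r :* (q :* h) := p :* q :* (h :* r)) refl (pow4 (suc i)) (recip (suc i)) (pow4 (n ∸ suc i)) (H (n ∸ suc i)) ⟩
    pow4 (suc i) * pow4 (n ∸ suc i) * (H (n ∸ suc i) * recip (suc i))
      ≡⟨ cong (_* (H (n ∸ suc i) * recip (suc i))) (pow4-+ (suc i) (n ∸ suc i)) ⟨
    pow4 (suc i ℕ.+ (n ∸ suc i)) * (H (n ∸ suc i) * recip (suc i))
      ≡⟨ cong (λ k → pow4 k * (H (n ∸ suc i) * recip (suc i))) (ℕP.m+[n∸m]≡n i<n) ⟩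
    pow4 n * (H (n ∸ suc i) * recip (suc i))
      ∎

twoPowS catalanS : ℕ → ℚ
twoPowS n = ⟦ 2 ℕ.^ (2 ℕ.* n ∸ 1) ⟧ * S n
catalanS n = sum0 n (λ j → pow4 (n ∸ j ∸ 1) * Cat j * S (n ∸ j ∸ 1))

-- S 0 = 0, so the truncation 2 * 0 ∸ 1 = 0 does no harm.
twoPowS≡½σ : ∀ n → twoPowS n ≡ ½ * σ n
twoPowS≡½σ zero    = refl
twoPowS≡½σ (suc m) = begin
  ⟦ 2 ℕ.^ (2 ℕ.* suc m ∸ 1) ⟧ * S (suc m)    ≡⟨ cong (λ k → ⟦ k ⟧ * S (suc m)) (2^[2[1+m]∸1]≡2*4^m m) ⟩
  ⟦ 2 ℕ.* 4 ℕ.^ m ⟧ * S (suc m)              ≡⟨ cong (_* S (suc m)) (⟦⟧-homo-* 2 (4 ℕ.^ m)) ⟩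
  ⟦ 2 ⟧ * pow4 m * S (suc m)                 ≡⟨ solve 2 (λ p s → con ⟦ 2 ⟧ :* p :* s := con ½ :* (con ⟦ 4 ⟧ :* p :* s)) refl (pow4 m) (S (suc m)) ⟩
  ½ * (⟦ 4 ⟧ * pow4 m * S (suc m))           ≡⟨ cong (λ z → ½ * (z * S (suc m))) (pow4-suc m) ⟨
  ½ * (pow4 (suc m) * S (suc m))             ≡⟨ cong (½ *_) (σ-coeff (suc m)) ⟨
  ½ * σ (suc m)                              ∎
  where
  open ≡-Reasoning
  2^[2[1+m]∸1]≡2*4^m : ∀ m → 2 ℕ.^ (2 ℕ.* suc m ∸ 1) ≡ 2 ℕ.* 4 ℕ.^ m
  2^[2[1+m]∸1]≡2*4^m m = begin
    2 ℕ.^ (2 ℕ.* suc m ∸ 1)   ≡⟨ cong (λ k → 2 ℕ.^ (k ∸ 1)) (2[1+m]≡2+2m m) ⟩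
    2 ℕ.* 2 ℕ.^ (2 ℕ.* m)     ≡⟨ cong (2 ℕ.*_) (ℕP.^-*-assoc 2 2 m) ⟨
    2 ℕ.* 4 ℕ.^ m             ∎

catalanS≡κ⊛σ : ∀ n → catalanS n ≡ (κ ⊛ σ) n
catalanS≡κ⊛σ n = begin
  sum0 n (λ j → pow4 (n ∸ j ∸ 1) * Cat j * S (n ∸ j ∸ 1))   ≡⟨ sum0-cong n termwise ⟩
  sum0 n (λ j → Cat j * σ (n ∸ suc j))                      ≡⟨ κ⊛-coeff σ n ⟨
  (κ ⊛ σ) n                                                 ∎
  where
  open ≡-Reasoning
  termwise : ∀ j → pow4 (n ∸ j ∸ 1) * Cat j * S (n ∸ j ∸ 1) ≡ Cat j * σ (n ∸ suc j)
  termwise j = begin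
    pow4 (n ∸ j ∸ 1) * Cat j * S (n ∸ j ∸ 1)   ≡⟨ cong (λ k → pow4 k * Cat j * S k) (n∸j∸1≡n∸[1+j] n j) ⟩
    pow4 k * Cat j * S k                       ≡⟨ solve 3 (λ p c s → p :* c :* s := c :* (p :* s)) refl (pow4 k) (Cat j) (S k) ⟩
    Cat j * (pow4 k * S k)                     ≡⟨ cong (Cat j *_) (σ-coeff k) ⟨
    Cat j * σ k                                ∎
    where k = n ∸ suc j

ℓ⊛ω-coeff : ∀ n → (ℓ ⊛ ω) n ≡ twoPowS n - catalanS n
ℓ⊛ω-coeff n = begin
  (ℓ ⊛ ω) n                          ≡⟨ ⊛ω≈½W⊛η⊛ ℓ n ⟩
  (scalar ½ ⊛ (W ⊛ σ)) n             ≡⟨ ½W⊛-coeff σ n ⟩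
  ½ * σ n - (κ ⊛ σ) n                ≡⟨ cong₂ _-_ (twoPowS≡½σ n) (catalanS≡κ⊛σ n) ⟨
  twoPowS n - catalanS n             ∎
  where open ≡-Reasoning

ε⊛ω-tail : ∀ n q → sum1 n (λ j → ε q j * ω (n ∸ j)) ≡ ½ * α (suc q) n - (κ ⊛ α (suc q)) n - ω n
ε⊛ω-tail n q = begin
  sum1 n (λ j → ε q j * ω (n ∸ j))
    ≡⟨ solve 2 (λ w s → s := con 1ℚ :* w :+ s :- w) refl (ω n) _ ⟩
  1ℚ * ω n + sum1 n (λ j → ε q j * ω (n ∸ j)) - ω n
    ≡⟨ cong (λ z → z * ω n + sum1 n (λ j → ε q j * ω (n ∸ j)) - ω n) (ε-coeff-zero q) ⟨
  ε q 0 * ω n + sum1 n (λ j → ε q j * ω (n ∸ j)) - ω n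
    ≡⟨ cong (_- ω n) (⊛-coeff (ε q) ω n) ⟨
  (ε q ⊛ ω) n - ω n
    ≡⟨ cong (_- ω n) (⊛ω≈½W⊛η⊛ (ε q) n) ⟩
  (scalar ½ ⊛ (W ⊛ (η ⊛ ε q))) n - ω n
    ≡⟨ cong (_- ω n) (⊛-congˡ (scalar ½) (⊛-congˡ W (η⊛ε≈α q)) n) ⟩
  (scalar ½ ⊛ (W ⊛ α (suc q))) n - ω n
    ≡⟨ cong (_- ω n) (½W⊛-coeff (α (suc q)) n) ⟩
  ½ * α (suc q) n - (κ ⊛ α (suc q)) n - ω n
    ∎
  where open ≡-Reasoning

catalanα : ℕ → ℕ → ℚ
catalanα n k = sum1 n (λ j → binom (j ℕ.+ k ∸ 1) (j ∸ 1) * pow4 j * (H (k ℕ.+ j ∸ 1) - H k) * Cat (n ∸ j))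

catalanα≡4κ⊛α : ∀ n q → catalanα n (suc q) ≡ ⟦ 4 ⟧ * (κ ⊛ α (suc q)) n
catalanα≡4κ⊛α n q = begin
  catalanα n (suc q)
    ≡⟨ sum1≡sum0∘suc n _ ⟩
  sum0 n (λ i → binom (i ℕ.+ suc q) i * pow4 (suc i) * (H (q ℕ.+ suc i) - H (suc q)) * Cat (n ∸ suc i))
    ≡⟨ sum0-cong n termwise ⟩
  sum0 n (λ i → ⟦ 4 ⟧ * (α (suc q) i * Cat (n ∸ suc i)))
    ≡⟨ sum0-*ˡ n ⟦ 4 ⟧ _ ⟩
  ⟦ 4 ⟧ * sum0 n (λ i → α (suc q) i * Cat (n ∸ suc i))
    ≡⟨ cong (⟦ 4 ⟧ *_) (κ⊛-coeff′ (α (suc q)) n) ⟨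
  ⟦ 4 ⟧ * (κ ⊛ α (suc q)) n
    ∎
  where
  open ≡-Reasoning
  termwise : ∀ i → binom (i ℕ.+ suc q) i * pow4 (suc i) * (H (q ℕ.+ suc i) - H (suc q)) * Cat (n ∸ suc i)
                ≡ ⟦ 4 ⟧ * (α (suc q) i * Cat (n ∸ suc i))
  termwise i = begin
    b * pow4 (suc i) * (H (q ℕ.+ suc i) - H (suc q)) * c
      ≡⟨ cong₂ (λ u k → b * u * (H k - H (suc q)) * c) (pow4-suc i) (trans (ℕP.+-suc q i) (cong suc (ℕP.+-comm q i))) ⟩
    b * (⟦ 4 ⟧ * pow4 i) * (H (suc (i ℕ.+ q)) - H (suc q)) * c
      ≡⟨ cong (λ k → b * (⟦ 4 ⟧ * pow4 i) * (H k - H (suc q)) * c) (ℕP.+-suc i q) ⟨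
    b * (⟦ 4 ⟧ * pow4 i) * h * c
      ≡⟨ solve 5 (λ b f p h c → b :* (f :* p) :* h :* c := f :* (p :* b :* h :* c)) refl b ⟦ 4 ⟧ (pow4 i) h c ⟩
    ⟦ 4 ⟧ * (α (suc q) i * c)
      ∎
    where
    b = binom (i ℕ.+ suc q) i
    h = H (i ℕ.+ suc q) - H (suc q)
    c = Cat (n ∸ suc i)

summand : ℕ → ℕ → ℕ → ℚ
summand n p j = binom (p ℕ.+ j) j * β (n ∸ j) * pow4 j * recip j * O (n ∸ j)

lhs : ℕ → ℕ → ℚ
lhs n p = sum1 n (summand n p)

correction : ℕ → ℕ → ℚ
correction n k = recip k * (α k n - ½ * catalanα n k)

rhs : ℕ → ℕ → ℚ
rhs n p = (- (β n * H p * O n)) + twoPowS n - catalanS n + ½ * sum1 p (correction n)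

lhs-suc : ∀ n q → lhs n (suc q) ≡ lhs n q + inv-suc q * sum1 n (λ j → ε q j * ω (n ∸ j))
lhs-suc n q = begin
  lhs n (suc q)                                                              ≡⟨ sum1-cong n pascal-split ⟩
  sum1 n (λ j → summand n q j + inv-suc q * (ε q j * ω (n ∸ j)))            ≡⟨ sum1-+ n _ _ ⟩
  lhs n q + sum1 n (λ j → inv-suc q * (ε q j * ω (n ∸ j)))                  ≡⟨ cong (lhs n q +_) (sum1-*ˡ n (inv-suc q) _) ⟩
  lhs n q + inv-suc q * sum1 n (λ j → ε q j * ω (n ∸ j))                    ∎
  where
  open ≡-Reasoning
  pascal-split : ∀ i → summand n (suc q) (suc i) ≡ summand n q (suc i) + inv-suc q * (ε q (suc i) * ω (n ∸ suc i))
  pascal-split i = begin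
    ⟦ suc N C suc i ⟧ * b * p * inv-suc i * o
      ≡⟨ cong (λ z → z * b * p * inv-suc i * o) (trans (cong ⟦_⟧ ([n+1]C[k+1]≡nCk+nC[k+1] N i)) (⟦⟧-homo-+ (N C i) (N C suc i))) ⟩
    (x + y) * b * p * inv-suc i * o
      ≡⟨ solve 6 (λ x y b p r o → (x :+ y) :* b :* p :* r :* o := y :* b :* p :* r :* o :+ x :* r :* (p :* (b :* o))) refl x y b p (inv-suc i) o ⟩
    y * b * p * inv-suc i * o + x * inv-suc i * (p * (b * o))
      ≡⟨ cong (λ z → y * b * p * inv-suc i * o + z * (p * (b * o))) (*inv-suc-swap q i (⟦1+q⟧*[q+1+i]Ci≡⟦1+i⟧*[q+1+i]C[1+i] q i)) ⟩
    y * b * p * inv-suc i * o + inv-suc q * y * (p * (b * o))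
      ≡⟨ cong (y * b * p * inv-suc i * o +_) (solve 5 (λ r y p b o → r :* y :* (p :* (b :* o)) := r :* (y :* p :* (b :* o))) refl (inv-suc q) y p b o) ⟩
    summand n q (suc i) + inv-suc q * (ε q (suc i) * ω (n ∸ suc i))
      ∎
    where
    N = q ℕ.+ suc i
    x = binom N i
    y = binom N (suc i)
    b = β (n ∸ suc i)
    p = pow4 (suc i)
    o = O (n ∸ suc i)

lhs₀ : ℕ → ℚ
lhs₀ n = sum1 n (λ j → β (n ∸ j) * pow4 j * recip j * O (n ∸ j))

lhs-zero : ∀ n → lhs n 0 ≡ lhs₀ n
lhs-zero n = sum1-cong n λ i → begin
  ⟦ suc i C suc i ⟧ * β (n ∸ suc i) * pow4 (suc i) * recip (suc i) * O (n ∸ suc i)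
    ≡⟨ cong (λ k → ⟦ k ⟧ * β (n ∸ suc i) * pow4 (suc i) * recip (suc i) * O (n ∸ suc i)) (nCn≡1 (suc i)) ⟩
  1ℚ * β (n ∸ suc i) * pow4 (suc i) * recip (suc i) * O (n ∸ suc i)
    ≡⟨ solve 4 (λ b p r o → con 1ℚ :* b :* p :* r :* o := b :* p :* r :* o) refl (β (n ∸ suc i)) (pow4 (suc i)) (recip (suc i)) (O (n ∸ suc i)) ⟩
  β (n ∸ suc i) * pow4 (suc i) * recip (suc i) * O (n ∸ suc i)
    ∎
  where open ≡-Reasoning

lhs₀≡ℓ⊛ω : ∀ n → lhs₀ n ≡ (ℓ ⊛ ω) n
lhs₀≡ℓ⊛ω n = trans (sum1-cong n λ i → rearrange (β (n ∸ suc i)) (pow4 (suc i)) (recip (suc i)) (O (n ∸ suc i)))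
                   (sym (⊛-coeff-sum1 ℓ ω n refl))
  where
  rearrange : ∀ b p r o → b * p * r * o ≡ p * r * (b * o)
  rearrange = solve 4 (λ b p r o → b :* p :* r :* o := p :* r :* (b :* o)) refl

catalanS-reversed : ∀ n → catalanS n ≡ sum1 n (λ j → pow4 (j ∸ 1) * Cat (n ∸ j) * S (j ∸ 1))
catalanS-reversed n = begin
  catalanS n                                       ≡⟨ catalanS≡κ⊛σ n ⟩
  (κ ⊛ σ) n                                        ≡⟨ κ⊛-coeff′ σ n ⟩
  sum0 n (λ i → σ i * Cat (n ∸ suc i))             ≡⟨ sum0-cong n (λ i → cong (_* Cat (n ∸ suc i)) (σ-coeff i)) ⟩
  sum0 n (λ i → pow4 i * S i * Cat (n ∸ suc i))    ≡⟨ sum0-cong n (λ i → solve 3 (λ p s c → p :* s :* c := p :* c :* s) refl (pow4 i) (S i) (Cat (n ∸ suc i))) ⟩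
  sum0 n (λ i → pow4 i * Cat (n ∸ suc i) * S i)    ≡⟨ sum1≡sum0∘suc n _ ⟨
  sum1 n (λ j → pow4 (j ∸ 1) * Cat (n ∸ j) * S (j ∸ 1)) ∎
  where open ≡-Reasoning

lhs≡rhs : ∀ n p → lhs n p ≡ rhs n p
lhs≡rhs n zero = begin
  lhs n 0                  ≡⟨ trans (lhs-zero n) (trans (lhs₀≡ℓ⊛ω n) (ℓ⊛ω-coeff n)) ⟩
  twoPowS n - catalanS n   ≡⟨ solve 4 (λ b o k c → k :- c := (:- (b :* con 0ℚ :* o)) :+ k :- c :+ con ½ :* con 0ℚ) refl (β n) (O n) (twoPowS n) (catalanS n) ⟩
  rhs n 0                  ∎
  where open ≡-Reasoning
lhs≡rhs n (suc q) = begin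
  lhs n (suc q)
    ≡⟨ lhs-suc n q ⟩
  lhs n q + r * sum1 n (λ j → ε q j * ω (n ∸ j))
    ≡⟨ cong₂ (λ u v → u + r * v) (lhs≡rhs n q) (ε⊛ω-tail n q) ⟩
  rhs n q + r * (½ * a - c - b * o)
    ≡⟨ solve 9 (λ b h r o k z g a c → (:- (b :* h :* o)) :+ k :- z :+ con ½ :* g :+ r :* (con ½ :* a :- c :- b :* o) :=
                    (:- (b :* (h :+ r) :* o)) :+ k :- z :+ con ½ :* (g :+ r :* (a :- con ½ :* (con ⟦ 4 ⟧ :* c))))
         refl b (H q) r o (twoPowS n) (catalanS n) (sum1 q (correction n)) a c ⟩
  (- (b * (H q + r) * o)) + twoPowS n - catalanS n + ½ * (sum1 q (correction n) + r * (a - ½ * (⟦ 4 ⟧ * c)))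
    ≡⟨ cong (λ z → (- (b * (H q + r) * o)) + twoPowS n - catalanS n + ½ * (sum1 q (correction n) + r * (a - ½ * z)))
            (catalanα≡4κ⊛α n q) ⟨
  rhs n (suc q)
    ∎
  where
  open ≡-Reasoning
  r = inv-suc q
  a = α (suc q) n
  c = (κ ⊛ α (suc q)) n
  b = β n
  o = O n

-- Both identities also hold for n = 0.
theorem7 :
  ((n p : ℕ) → n ≥ 1 →
    sum1 n (λ j → binom (p ℕ.+ j) j * binom (2 ℕ.* (n ∸ j)) (n ∸ j) * pow4 j * recip j * O (n ∸ j))
    ≡
    (- (binom (2 ℕ.* n) n * H p * O n)) + ⟦ 2 ℕ.^ (2 ℕ.* n ∸ 1) ⟧ * S n
      - sum0 n (λ j → pow4 (n ∸ j ∸ 1) * Cat j * S (n ∸ j ∸ 1))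
      + ½ * sum1 p (λ k → recip k *
          (pow4 n * binom (n ℕ.+ k) n * (H (n ℕ.+ k) - H k)
            - ½ * sum1 n (λ j → binom (j ℕ.+ k ∸ 1) (j ∸ 1) * pow4 j * (H (k ℕ.+ j ∸ 1) - H k) * Cat (n ∸ j)))))
  ×
  ((n : ℕ) → n ≥ 1 →
    sum1 n (λ j → binom (2 ℕ.* (n ∸ j)) (n ∸ j) * pow4 j * recip j * O (n ∸ j))
    ≡
    ⟦ 2 ℕ.^ (2 ℕ.* n ∸ 1) ⟧ * S n - sum1 n (λ j → pow4 (j ∸ 1) * Cat (n ∸ j) * S (j ∸ 1)))
theorem7 = (λ n p _ → lhs≡rhs n p) , λ n _ → begin
  lhs₀ n                   ≡⟨ lhs₀≡ℓ⊛ω n ⟩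
  (ℓ ⊛ ω) n                ≡⟨ ℓ⊛ω-coeff n ⟩
  twoPowS n - catalanS n   ≡⟨ cong (_-_ (twoPowS n)) (catalanS-reversed n) ⟩
  twoPowS n - sum1 n (λ j → pow4 (j ∸ 1) * Cat (n ∸ j) * S (j ∸ 1)) ∎
  where open ≡-Reasoning
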